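{- Let $p$ be an odd prime, $\alpha,\beta\in\mathbb Z_p$ and $\gamma\in\mathbb Z_p^\times$ with $\langle-\alpha\rangle_p\le\langle-\gamma\rangle_p$ and $\langle-\beta\rangle_p\leq\langle-\gamma\rangle_p$. (i) If $\langle-\alpha\rangle_p+\langle-\beta\rangle_p\leq\langle-\gamma\rangle_p$, then $$ {}_2F_1\bigg[\begin{matrix}\alpha&\beta\\&\gamma\end{matrix}\bigg|\,1\bigg]_{\langle-\gamma\rangle_p}\equiv\frac{\Gamma_p(\gamma)\Gamma_p(\gamma-\alpha-\beta)}{\Gamma_p(\gamma-\alpha)\Gamma_p(\gamma-\beta)}\pmod{p^2}. $$ (ii) If $\langle-\alpha\rangle_p+\langle-\beta\rangle_p>\langle-\gamma\rangle_p$, then $$ {}_2F_1\bigg[\begin{matrix}\alpha&\beta\\&\gamma\end{matrix}\bigg|\,1\bigg]_{\langle-\gamma\rangle_p}\equiv (\gamma+\langle-\gamma\rangle_p-\alpha-\langle-\alpha\rangle_p-\beta-\langle-\beta\rangle_p)\cdot \frac{\Gamma_p(\gamma)\Gamma_p(\gamma-\alpha-\beta)}{\Gamma_p(\gamma-\alpha)\Gamma_p(\gamma-\beta)}\pmod{p^2}. $$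
   Context: $\mathbb Z_p$ denotes the $p$-adic integers and $\mathbb Z_p^\times$ its units. For $\alpha\in\mathbb Z_p$, $\langle\alpha\rangle_p$ is the unique integer in $\{0,1,\ldots,p-1\}$ congruent to $\alpha$ modulo $p$. Pochhammer symbol: $(x)_0=1$, $(x)_k=x(x+1)\cdots(x+k-1)$. For $n\ge 0$, ${}_{2}F_1\Big[\begin{matrix}\alpha&\beta\\&\gamma\end{matrix}\Big|\,z\Big]_n=\sum_{k=0}^{n}\frac{(\alpha)_k(\beta)_k}{(\gamma)_k}\cdot\frac{z^k}{k!}$. $\Gamma_p$ is Morita's $p$-adic gamma function: $\Gamma_p(n)=(-1)^n\prod_{1\le j<n,\ p\nmid j}j$ for integers $n\ge1$, $\Gamma_p(0)=1$, extended to $\mathbb Z_p$ by continuity. For $x,y\in\mathbb Q_p$, $x\equiv y\pmod{p^2}$ means $x-y\in p^2\mathbb Z_p$. -}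

module Defs where

import Data.Nat as ℕ
open ℕ using (ℕ; zero; suc; _≤_; _<_; _∸_)
open import Data.Nat.Divisibility using (_∣_; _∣?_)
import Data.Integer as ℤ
open ℤ using (ℤ; +_)
import Data.Rational as ℚ
open ℚ using (ℚ; 0ℚ; 1ℚ; _÷_; ≢-nonZero)
open import Data.Rational.Properties using (_≟_)
open import Data.Product using (Σ; _×_; ∃)
open import Relation.Nullary using (¬_; yes; no)
open import Relation.Binary.PropositionalEquality using (_≡_)

-- A p-adic integer, given by its base-p digit expansion  Σ_i digit i * p^i.
record ℤₚ (p : ℕ) : Set where
  field
    digit   : ℕ → ℕ
    digit<p : ∀ i → digit i < p
open ℤₚ public

trunc : ∀ {p} → ℤₚ p → ℕ → ℕ
trunc {p} a zero    = 0
trunc {p} a (suc n) = trunc a n ℕ.+ digit a n ℕ.* (p ℕ.^ n)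

IsUnit : ∀ {p} → ℤₚ p → Set
IsUnit a = ¬ (digit a 0 ≡ 0)

-- ⟨-α⟩_p : the element of {0,…,p-1} congruent to -α mod p
negRes : ∀ {p} → ℤₚ p → ℕ
negRes {p} a with digit a 0
... | zero  = 0
... | suc d = p ∸ suc d

-- total division on ℚ (x / 0 := 0); only ever used with nonzero divisors eventually
_÷'_ : ℚ → ℚ → ℚ
x ÷' y with y ≟ 0ℚ
... | yes _ = 0ℚ
... | no ne = _÷_ x y {{≢-nonZero ne}}

poch : ℚ → ℕ → ℚ
poch x zero    = 1ℚ
poch x (suc k) = poch x k ℚ.* (x ℚ.+ ((+ k) ℚ./ 1))

fact : ℕ → ℚ
fact k = (+ (k ℕ.!)) ℚ./ 1

F21-1 : ℚ → ℚ → ℚ → ℕ → ℚ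
F21-1 a b c zero    = 1ℚ
F21-1 a b c (suc n) = F21-1 a b c n ℚ.+
  ((poch a (suc n) ℚ.* poch b (suc n)) ÷' (poch c (suc n) ℚ.* fact (suc n)))

-- product of j with 1 ≤ j < n and p ∤ j
prodCoprime : ℕ → ℕ → ℤ
prodCoprime p zero    = + 1
prodCoprime p (suc j) with p ∣? j
... | yes _ = prodCoprime p j
... | no  _ = prodCoprime p j ℤ.* (+ j)

-- Morita's p-adic gamma function on natural numbers:
-- Γ_p(n) = (-1)^n ∏_{1≤j<n, p∤j} j   (Γ_p(0) = 1)
-- (j = 0 is never a factor: p ∣ 0)
Γₚℕ : ℕ → ℕ → ℤ
Γₚℕ p n = sgn n ℤ.* prodCoprime p n
  where
  sgn : ℕ → ℤ
  sgn zero          = + 1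
  sgn (suc zero)    = ℤ.-[1+ 0 ]
  sgn (suc (suc k)) = sgn k

-- x ≡ y (mod p^k) for rationals, in ℚ_p:  x - y ∈ p^k ℤ_p
CongQ : ℕ → ℕ → ℚ → ℚ → Set
CongQ p k x y =
  (p ℕ.^ k) ∣ ℤ.∣ ℚ.↥ (x ℚ.- y) ∣ × ¬ (p ∣ ℤ.∣ ℚ.↧ (x ℚ.- y) ∣)

Eventually : (ℕ → Set) → Set
Eventually P = ∃ λ N → ∀ n → N ≤ n → P n

-- Approximations at level n (natural-number representatives converging p-adically):
--   γ - α      ~  trunc γ n + p^n - trunc α n
--   γ - α - β  ~  trunc γ n + 2 p^n - trunc α n - trunc β n
-- Γ_p on ℤ_p is the p-adic limit of Γ_p on these representatives (continuity).
ℚℕ : ℕ → ℚ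
ℚℕ n = (+ n) ℚ./ 1

GammaQuot : (p : ℕ) → ℤₚ p → ℤₚ p → ℤₚ p → ℕ → ℚ
GammaQuot p α β γ n =
  ((Γₚℕ p c ℤ.* Γₚℕ p ((c ℕ.+ 2 ℕ.* P) ∸ (a ℕ.+ b))) ℚ./ 1)
  ÷' ((Γₚℕ p ((c ℕ.+ P) ∸ a) ℤ.* Γₚℕ p ((c ℕ.+ P) ∸ b)) ℚ./ 1)
  where
  a = trunc α n
  b = trunc β n
  c = trunc γ n
  P = p ℕ.^ n

F21Approx : (p : ℕ) → ℤₚ p → ℤₚ p → ℤₚ p → ℕ → ℚ
F21Approx p α β γ n =
  F21-1 (ℚℕ (trunc α n)) (ℚℕ (trunc β n)) (ℚℕ (trunc γ n)) (negRes γ)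

FactorApprox : (p : ℕ) → ℤₚ p → ℤₚ p → ℤₚ p → ℕ → ℚ
FactorApprox p α β γ n =
  ((ℚℕ (trunc γ n) ℚ.+ ℚℕ (negRes γ)) ℚ.- (ℚℕ (trunc α n) ℚ.+ ℚℕ (negRes α)))
    ℚ.- (ℚℕ (trunc β n) ℚ.+ ℚℕ (negRes β))

{-# OPTIONS --safe #-}
-- Fix natural representatives A, B, C of α, β, γ modulo P = p^n (n ≥ 2) and put a = ⟨-α⟩ₚ,
-- b = ⟨-β⟩ₚ, c = ⟨-γ⟩ₚ, T(x, y) = 2F1[x, y; C | 1]_c. At x = -a the series terminates and the
-- Chu–Vandermonde identity gives T(-a, y) · D(-a, y) = N(-a, y) for explicit products N, D of
-- Pochhammer symbols; symmetrically at y = -b. So G = T · D - N, a polynomial with p-integral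
-- coefficients, vanishes on both lines x = -a and y = -b, and as A ≡ -a, B ≡ -b (mod p) its mixed
-- second difference yields G(A, B) ≡ 0, i.e. T(A, B) ≡ N/D (mod p²).
-- On the other side, for odd p the product of the integers prime to p in a block of p consecutive
-- integers starting at a multiple of p is ≡ (p - 1)! (mod p²): its linear term is p Σ 1/j ≡ 0.
-- Hence each Γₚ value is ± (p - 1)!^X over a Pochhammer product reaching the next multiple of p,
-- and the Γₚ quotient reduces to the same Pochhammer products as N/D. In case (ii) one extra block
-- (F)_p ≡ F · (p - 1)! with p ∣ F appears, F being the linear factor of the statement.
module Submission where

open import Data.Nat as ℕ using (ℕ; zero; suc; _≤_; _<_; _∸_; _^_; z≤n; s≤s)
import Data.Nat.Properties as ℕP
import Data.Nat.Divisibility as ℕD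
open import Data.Nat.Primality using (Prime; euclidsLemma; prime⇒nonTrivial; composite)
open import Data.Nat.Coprimality using (Coprime; coprime?)
open import Data.Integer as ℤ using (ℤ; +_; -[1+_])
import Data.Integer.Properties as ℤP
open import Data.Integer.Divisibility.Signed using (_∣_; divides; ∣ᵤ⇒∣; ∣⇒∣ᵤ)
import Data.Integer.Divisibility.Signed as ℤD
open import Data.Rational as ℚ using (ℚ; 0ℚ; 1ℚ; ↥_; ↧_; toℚᵘ)
import Data.Rational.Properties as ℚP
import Data.Rational.Unnormalised as ℚᵘ
import Data.Rational.Unnormalised.Properties as ℚᵘP
import Data.Rational.Solver as ℚSolver
import Data.Integer.Solver as ℤSolver
import Data.Nat.Solver as ℕSolver
open import Data.Product using (Σ; _×_; _,_)
open import Data.Sum using (_⊎_; inj₁; inj₂; [_,_]′)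
open import Data.Empty using (⊥-elim)
open import Relation.Nullary using (¬_; yes; no; Dec)
open import Relation.Nullary.Decidable using (recompute)
open import Relation.Binary.PropositionalEquality
open import Function using (_$_)
open import Level using (0ℓ)
open import Relation.Binary.Bundles using (Setoid)
import Relation.Binary.Reasoning.Setoid as SetoidReasoning
open import Defs


-- fromℤ (+ n) is definitionally ℚℕ n, and GammaQuot is built from fromℤ.
fromℤ : ℤ → ℚ
fromℤ i = i ℚ./ 1

private
  toℚᵘ-fromℤ : ∀ i → toℚᵘ (fromℤ i) ℚᵘ.≃ ℚᵘ.mkℚᵘ i 0
  toℚᵘ-fromℤ i = ℚP.toℚᵘ-fromℚᵘ (ℚᵘ.mkℚᵘ i 0)

  toℚᵘ-fromℤ⁻¹ : ∀ i → ℚᵘ.mkℚᵘ i 0 ℚᵘ.≃ toℚᵘ (fromℤ i)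
  toℚᵘ-fromℤ⁻¹ i = ℚᵘP.≃-sym (toℚᵘ-fromℤ i)

fromℤ-+ : ∀ i j → fromℤ (i ℤ.+ j) ≡ fromℤ i ℚ.+ fromℤ j
fromℤ-+ i j = ℚP.toℚᵘ-injective $ ℚᵘP.≃-trans (toℚᵘ-fromℤ (i ℤ.+ j)) $
  ℚᵘP.≃-trans (ℚᵘ.*≡* (cong (ℤ._* + 1) (sym (cong₂ ℤ._+_ (ℤP.*-identityʳ i) (ℤP.*-identityʳ j))))) $
  ℚᵘP.≃-trans (ℚᵘP.+-cong (toℚᵘ-fromℤ⁻¹ i) (toℚᵘ-fromℤ⁻¹ j)) (ℚᵘP.≃-sym (ℚP.toℚᵘ-homo-+ (fromℤ i) (fromℤ j)))

fromℤ-* : ∀ i j → fromℤ (i ℤ.* j) ≡ fromℤ i ℚ.* fromℤ j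
fromℤ-* i j = ℚP.toℚᵘ-injective $ ℚᵘP.≃-trans (toℚᵘ-fromℤ (i ℤ.* j)) $
  ℚᵘP.≃-trans (ℚᵘP.*-cong (toℚᵘ-fromℤ⁻¹ i) (toℚᵘ-fromℤ⁻¹ j)) (ℚᵘP.≃-sym (ℚP.toℚᵘ-homo-* (fromℤ i) (fromℤ j)))

fromℤ-neg : ∀ i → fromℤ (ℤ.- i) ≡ ℚ.- fromℤ i
fromℤ-neg i = ℚP.toℚᵘ-injective $ ℚᵘP.≃-trans (toℚᵘ-fromℤ (ℤ.- i)) $
  ℚᵘP.≃-trans (ℚᵘP.-‿cong (toℚᵘ-fromℤ⁻¹ i)) (ℚᵘP.≃-sym (ℚP.toℚᵘ-homo‿- (fromℤ i)))

fromℤ-- : ∀ i j → fromℤ (i ℤ.- j) ≡ fromℤ i ℚ.- fromℤ j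
fromℤ-- i j = trans (fromℤ-+ i (ℤ.- j)) (cong (fromℤ i ℚ.+_) (fromℤ-neg j))

fromℤ-injective : ∀ {i j} → fromℤ i ≡ fromℤ j → i ≡ j
fromℤ-injective {i} {j} e with ℚᵘP.≃-trans (toℚᵘ-fromℤ⁻¹ i) (ℚᵘP.≃-trans (ℚP.toℚᵘ-cong e) (toℚᵘ-fromℤ j))
... | ℚᵘ.*≡* eq = trans (sym (ℤP.*-identityʳ i)) (trans eq (ℤP.*-identityʳ j))

*-fromℤ⇒↥*≡*↧ : ∀ q d n → q ℚ.* fromℤ d ≡ fromℤ n → ↥ q ℤ.* d ≡ n ℤ.* ↧ q
*-fromℤ⇒↥*≡*↧ q@record{} d n e
  with ℚᵘP.≃-trans (ℚᵘP.*-cong (ℚᵘP.≃-refl {toℚᵘ q}) (toℚᵘ-fromℤ⁻¹ d))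
         (ℚᵘP.≃-trans (ℚᵘP.≃-sym (ℚP.toℚᵘ-homo-* q (fromℤ d))) (ℚᵘP.≃-trans (ℚP.toℚᵘ-cong e) (toℚᵘ-fromℤ n)))
... | ℚᵘ.*≡* eq = trans (sym (ℤP.*-identityʳ _)) (trans eq (cong (n ℤ.*_) (ℤP.*-identityʳ (↧ q))))

^-monoʳ-∣ : ∀ m {k n} → k ≤ n → m ^ k ℕD.∣ m ^ n
^-monoʳ-∣ m {k} {n} k≤n = ℕD.divides (m ^ (n ∸ k)) (trans (cong (m ^_) (sym (ℕP.m∸n+n≡m k≤n))) (ℕP.^-distribˡ-+-* m (n ∸ k) k))

↥-↧-coprime : ∀ q → Coprime ℤ.∣ ↥ q ∣ ℤ.∣ ↧ q ∣
↥-↧-coprime (ℚ.mkℚ n d c) = recompute (coprime? ℤ.∣ n ∣ (suc d)) c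

ℚℕ-+ : ∀ m n → ℚℕ (m ℕ.+ n) ≡ ℚℕ m ℚ.+ ℚℕ n
ℚℕ-+ m n = trans (cong fromℤ (ℤP.pos-+ m n)) (fromℤ-+ (+ m) (+ n))

ℚℕ-* : ∀ m n → ℚℕ (m ℕ.* n) ≡ ℚℕ m ℚ.* ℚℕ n
ℚℕ-* m n = trans (cong fromℤ (ℤP.pos-* m n)) (fromℤ-* (+ m) (+ n))

module _ where
  open import Data.Rational using (_+_; _*_; _-_; -_)
  open ℚSolver.+-*-Solver
  open ≡-Reasoning

  ÷'-inverseʳ : ∀ y → y ≢ 0ℚ → y * (1ℚ ÷' y) ≡ 1ℚ
  ÷'-inverseʳ y y≢0 with y ℚP.≟ 0ℚ
  ... | yes y≡0 = ⊥-elim (y≢0 y≡0)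
  ... | no y≢0′ = trans (cong (y *_) (ℚP.*-identityˡ (ℚ.1/ y))) (ℚP.*-inverseʳ y)
    where instance _ = ℚ.≢-nonZero y≢0′

  ÷'≡*1÷' : ∀ x y → x ÷' y ≡ x * (1ℚ ÷' y)
  ÷'≡*1÷' x y with y ℚP.≟ 0ℚ
  ... | yes _ = sym (ℚP.*-zeroʳ x)
  ... | no y≢0 = cong (x *_) (sym (ℚP.*-identityˡ (ℚ.1/ y)))
    where instance _ = ℚ.≢-nonZero y≢0

  *≡1⇒≡1÷' : ∀ y w → y * w ≡ 1ℚ → y ≢ 0ℚ → w ≡ 1ℚ ÷' y
  *≡1⇒≡1÷' y w yw≡1 y≢0 = begin
    w               ≡⟨ sym (ℚP.*-identityˡ w) ⟩
    1ℚ * w          ≡⟨ cong (_* w) (sym (÷'-inverseʳ y y≢0)) ⟩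
    (y * v) * w     ≡⟨ solve 3 (λ y v w → (y :* v) :* w := (y :* w) :* v) refl y v w ⟩
    (y * w) * v     ≡⟨ cong (_* v) yw≡1 ⟩
    1ℚ * v          ≡⟨ ℚP.*-identityˡ v ⟩
    v               ∎
    where v = 1ℚ ÷' y

  *≢0 : ∀ {x y} → x ≢ 0ℚ → y ≢ 0ℚ → x * y ≢ 0ℚ
  *≢0 {x} {y} x≢0 y≢0 xy≡0 = y≢0 (begin
    y             ≡⟨ sym (ℚP.*-identityˡ y) ⟩
    1ℚ * y        ≡⟨ cong (_* y) (sym (÷'-inverseʳ x x≢0)) ⟩
    (x * v) * y   ≡⟨ solve 3 (λ x v y → (x :* v) :* y := v :* (x :* y)) refl x v y ⟩
    v * (x * y)   ≡⟨ cong (v *_) xy≡0 ⟩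
    v * 0ℚ        ≡⟨ ℚP.*-zeroʳ v ⟩
    0ℚ            ∎)
    where v = 1ℚ ÷' x

  1÷'-* : ∀ x y → y ≢ 0ℚ → 1ℚ ÷' (x * y) ≡ (1ℚ ÷' x) * (1ℚ ÷' y)
  1÷'-* x y y≢0 = by-cases (x ℚP.≟ 0ℚ)
    where
    xy·v≡1 : x ≢ 0ℚ → (x * y) * ((1ℚ ÷' x) * (1ℚ ÷' y)) ≡ 1ℚ
    xy·v≡1 x≢0 = begin
      (x * y) * ((1ℚ ÷' x) * (1ℚ ÷' y)) ≡⟨ solve 4 (λ x y u v → (x :* y) :* (u :* v) := (x :* u) :* (y :* v)) refl x y (1ℚ ÷' x) (1ℚ ÷' y) ⟩
      (x * (1ℚ ÷' x)) * (y * (1ℚ ÷' y)) ≡⟨ cong₂ _*_ (÷'-inverseʳ x x≢0) (÷'-inverseʳ y y≢0) ⟩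
      1ℚ * 1ℚ                           ≡⟨ ℚP.*-identityˡ 1ℚ ⟩
      1ℚ                                ∎
    by-cases : Dec (x ≡ 0ℚ) → 1ℚ ÷' (x * y) ≡ (1ℚ ÷' x) * (1ℚ ÷' y)
    by-cases (yes refl) = trans (cong (1ℚ ÷'_) (ℚP.*-zeroˡ y)) (sym (ℚP.*-zeroˡ (1ℚ ÷' y)))
    by-cases (no x≢0) = sym (*≡1⇒≡1÷' (x * y) ((1ℚ ÷' x) * (1ℚ ÷' y)) (xy·v≡1 x≢0) (*≢0 x≢0 y≢0))

  ÷'-*-cancelʳ : ∀ x y w → w ≢ 0ℚ → (x * w) ÷' (y * w) ≡ x ÷' y
  ÷'-*-cancelʳ x y w w≢0 = begin
    (x * w) ÷' (y * w)                       ≡⟨ ÷'≡*1÷' (x * w) (y * w) ⟩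
    (x * w) * (1ℚ ÷' (y * w))                ≡⟨ cong ((x * w) *_) (1÷'-* y w w≢0) ⟩
    (x * w) * ((1ℚ ÷' y) * (1ℚ ÷' w))        ≡⟨ solve 4 (λ x w u v → (x :* w) :* (u :* v) := (x :* u) :* (w :* v)) refl x w (1ℚ ÷' y) (1ℚ ÷' w) ⟩
    (x * (1ℚ ÷' y)) * (w * (1ℚ ÷' w))        ≡⟨ cong ((x * (1ℚ ÷' y)) *_) (÷'-inverseʳ w w≢0) ⟩
    (x * (1ℚ ÷' y)) * 1ℚ                     ≡⟨ ℚP.*-identityʳ _ ⟩
    x * (1ℚ ÷' y)                            ≡⟨ sym (÷'≡*1÷' x y) ⟩
    x ÷' y                                   ∎

  +-fraction : ∀ q r n₁ d₁ n₂ d₂ → q * fromℤ d₁ ≡ fromℤ n₁ → r * fromℤ d₂ ≡ fromℤ n₂ →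
               (q + r) * fromℤ (d₁ ℤ.* d₂) ≡ fromℤ (n₁ ℤ.* d₂ ℤ.+ n₂ ℤ.* d₁)
  +-fraction q r n₁ d₁ n₂ d₂ e₁ e₂ = begin
    (q + r) * fromℤ (d₁ ℤ.* d₂)                    ≡⟨ cong ((q + r) *_) (fromℤ-* d₁ d₂) ⟩
    (q + r) * (fromℤ d₁ * fromℤ d₂)                ≡⟨ solve 4 (λ q r a b → (q :+ r) :* (a :* b) := (q :* a) :* b :+ (r :* b) :* a) refl q r (fromℤ d₁) (fromℤ d₂) ⟩
    (q * fromℤ d₁) * fromℤ d₂ + (r * fromℤ d₂) * fromℤ d₁ ≡⟨ cong₂ (λ s t → s * fromℤ d₂ + t * fromℤ d₁) e₁ e₂ ⟩
    fromℤ n₁ * fromℤ d₂ + fromℤ n₂ * fromℤ d₁      ≡⟨ sym (cong₂ _+_ (fromℤ-* n₁ d₂) (fromℤ-* n₂ d₁)) ⟩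
    fromℤ (n₁ ℤ.* d₂) + fromℤ (n₂ ℤ.* d₁)          ≡⟨ sym (fromℤ-+ (n₁ ℤ.* d₂) (n₂ ℤ.* d₁)) ⟩
    fromℤ (n₁ ℤ.* d₂ ℤ.+ n₂ ℤ.* d₁)                ∎

  neg-fraction : ∀ q n d → q * fromℤ d ≡ fromℤ n → (- q) * fromℤ d ≡ fromℤ (ℤ.- n)
  neg-fraction q n d e = begin
    (- q) * fromℤ d   ≡⟨ solve 2 (λ q a → (:- q) :* a := :- (q :* a)) refl q (fromℤ d) ⟩
    - (q * fromℤ d)   ≡⟨ cong -_ e ⟩
    - fromℤ n         ≡⟨ sym (fromℤ-neg n) ⟩
    fromℤ (ℤ.- n)     ∎

  *-fraction : ∀ q r n₁ d₁ n₂ d₂ → q * fromℤ d₁ ≡ fromℤ n₁ → r * fromℤ d₂ ≡ fromℤ n₂ →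
               (q * r) * fromℤ (d₁ ℤ.* d₂) ≡ fromℤ (n₁ ℤ.* n₂)
  *-fraction q r n₁ d₁ n₂ d₂ e₁ e₂ = begin
    (q * r) * fromℤ (d₁ ℤ.* d₂)              ≡⟨ cong ((q * r) *_) (fromℤ-* d₁ d₂) ⟩
    (q * r) * (fromℤ d₁ * fromℤ d₂)          ≡⟨ solve 4 (λ q r a b → (q :* r) :* (a :* b) := (q :* a) :* (r :* b)) refl q r (fromℤ d₁) (fromℤ d₂) ⟩
    (q * fromℤ d₁) * (r * fromℤ d₂)          ≡⟨ cong₂ _*_ e₁ e₂ ⟩
    fromℤ n₁ * fromℤ n₂                      ≡⟨ sym (fromℤ-* n₁ n₂) ⟩
    fromℤ (n₁ ℤ.* n₂)                        ∎

  ÷'-fraction : ∀ x y n₁ d₁ n₂ d₂ → x * fromℤ d₁ ≡ fromℤ n₁ → y * fromℤ d₂ ≡ fromℤ n₂ → y ≢ 0ℚ →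
                (x ÷' y) * fromℤ (d₁ ℤ.* n₂) ≡ fromℤ (n₁ ℤ.* d₂)
  ÷'-fraction x y n₁ d₁ n₂ d₂ e₁ e₂ y≢0 = begin
    (x ÷' y) * fromℤ (d₁ ℤ.* n₂)                    ≡⟨ cong₂ _*_ (÷'≡*1÷' x y) (trans (fromℤ-* d₁ n₂) (cong (fromℤ d₁ *_) (sym e₂))) ⟩
    (x * v) * (fromℤ d₁ * (y * fromℤ d₂))           ≡⟨ solve 5 (λ x v a y b → (x :* v) :* (a :* (y :* b)) := ((x :* a) :* (y :* v)) :* b) refl x v (fromℤ d₁) y (fromℤ d₂) ⟩
    ((x * fromℤ d₁) * (y * v)) * fromℤ d₂           ≡⟨ cong₂ (λ s t → (s * t) * fromℤ d₂) e₁ (÷'-inverseʳ y y≢0) ⟩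
    (fromℤ n₁ * 1ℚ) * fromℤ d₂                      ≡⟨ cong (_* fromℤ d₂) (ℚP.*-identityʳ (fromℤ n₁)) ⟩
    fromℤ n₁ * fromℤ d₂                             ≡⟨ sym (fromℤ-* n₁ d₂) ⟩
    fromℤ (n₁ ℤ.* d₂)                               ∎
    where v = 1ℚ ÷' y

module PAdic (p : ℕ) (p-prime : Prime p) where
  open import Data.Rational using (_+_; _*_; _-_; -_)
  open ℚSolver.+-*-Solver

  1<p : 1 < p
  1<p = ℕ.nonTrivial⇒n>1 p {{prime⇒nonTrivial p-prime}}

  instance
    +p≢0 : ℤ.NonZero (+ p)
    +p≢0 = ℤ.≢-nonZero (λ p≡0 → ℕP.<⇒≢ (ℕP.<-trans ℕP.0<1+n 1<p) (sym (ℤP.+-injective p≡0)))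

  p∤_ : ℤ → Set
  p∤ d = ¬ (+ p ∣ d)

  p∣*⇒p∣⊎p∣ : ∀ a b → + p ∣ a ℤ.* b → + p ∣ a ⊎ + p ∣ b
  p∣*⇒p∣⊎p∣ a b p∣ab with euclidsLemma ℤ.∣ a ∣ ℤ.∣ b ∣ p-prime (subst (p ℕD.∣_) (ℤP.abs-* a b) (∣⇒∣ᵤ p∣ab))
  ... | inj₁ p∣a = inj₁ (∣ᵤ⇒∣ p∣a)
  ... | inj₂ p∣b = inj₂ (∣ᵤ⇒∣ p∣b)

  p∤-* : ∀ {a b} → p∤ a → p∤ b → p∤ (a ℤ.* b)
  p∤-* {a} {b} p∤a p∤b p∣ab = [ p∤a , p∤b ]′ (p∣*⇒p∣⊎p∣ a b p∣ab)

  p∤1 : p∤ (+ 1)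
  p∤1 p∣1 = ℕP.<⇒≢ 1<p (sym (ℕD.∣1⇒≡1 (∣⇒∣ᵤ p∣1)))

  p∣*-p∤⇒p∣ : ∀ {a d} → + p ∣ a ℤ.* d → p∤ d → + p ∣ a
  p∣*-p∤⇒p∣ {a} {d} p∣ad p∤d = [ (λ p∣a → p∣a) , (λ p∣d → ⊥-elim (p∤d p∣d)) ]′ (p∣*⇒p∣⊎p∣ a d p∣ad)

  p^∣*-p∤⇒p^∣ : ∀ k {a d} → + (p ^ k) ∣ a ℤ.* d → p∤ d → + (p ^ k) ∣ a
  p^∣*-p∤⇒p^∣ zero _ _ = ∣ᵤ⇒∣ (ℕD.1∣ _)
  p^∣*-p∤⇒p^∣ (suc k) {a} {d} p^k+1∣ad p∤d with p∣*-p∤⇒p∣ {a} {d} (ℤD.∣-trans (∣ᵤ⇒∣ (ℕD.m∣m*n (p ^ k))) p^k+1∣ad) p∤d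
  ... | divides s refl = subst (_∣ s ℤ.* + p) p^k*p≡p^k+1 (ℤD.*-monoˡ-∣ (+ p) p^k∣s)
    where
    p^k*p≡p^k+1 : + (p ^ k) ℤ.* + p ≡ + (p ^ suc k)
    p^k*p≡p^k+1 = trans (sym (ℤP.pos-* (p ^ k) p)) (cong +_ (ℕP.*-comm (p ^ k) p))
    p^k∣sd : + (p ^ k) ∣ s ℤ.* d
    p^k∣sd = ℤD.*-cancelʳ-∣ (+ p) (subst₂ _∣_ (sym p^k*p≡p^k+1)
               (trans (ℤP.*-assoc s (+ p) d) (trans (cong (s ℤ.*_) (ℤP.*-comm (+ p) d)) (sym (ℤP.*-assoc s d (+ p)))))
               p^k+1∣ad)
    p^k∣s : + (p ^ k) ∣ s
    p^k∣s = p^∣*-p∤⇒p^∣ k p^k∣sd p∤d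

  -- v_p(q) ≥ k, witnessed by any fraction num/den for q, not necessarily reduced.
  infix 4 _≤ᵥ_
  record _≤ᵥ_ (k : ℕ) (q : ℚ) : Set where
    constructor fraction
    field
      num den   : ℤ
      p∤den     : p∤ den
      p^k∣num   : + (p ^ k) ∣ num
      q*den≡num : q * fromℤ den ≡ fromℤ num

  ≤ᵥ-fromℤ : ∀ {k n} → + (p ^ k) ∣ n → k ≤ᵥ fromℤ n
  ≤ᵥ-fromℤ {k} {n} p^k∣n = fraction n (+ 1) p∤1 p^k∣n (ℚP.*-identityʳ (fromℤ n))

  0≤ᵥfromℤ : ∀ n → 0 ≤ᵥ fromℤ n
  0≤ᵥfromℤ n = ≤ᵥ-fromℤ {n = n} (∣ᵤ⇒∣ (ℕD.1∣ _))

  0≤ᵥℚℕ : ∀ n → 0 ≤ᵥ ℚℕ n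
  0≤ᵥℚℕ n = 0≤ᵥfromℤ (+ n)

  p^∣⇒≤ᵥℚℕ : ∀ {k n} → p ^ k ℕD.∣ n → k ≤ᵥ ℚℕ n
  p^∣⇒≤ᵥℚℕ {n = n} p^k∣n = ≤ᵥ-fromℤ {n = + n} (∣ᵤ⇒∣ p^k∣n)

  ≤ᵥ-0ℚ : ∀ {k} → k ≤ᵥ 0ℚ
  ≤ᵥ-0ℚ {k} = ≤ᵥ-fromℤ {n = + 0} (∣ᵤ⇒∣ ((p ^ k) ℕD.∣0))

  ≤ᵥ-+ : ∀ {k q r} → k ≤ᵥ q → k ≤ᵥ r → k ≤ᵥ q + r
  ≤ᵥ-+ {q = q} {r} (fraction n₁ d₁ p∤d₁ p^k∣n₁ e₁) (fraction n₂ d₂ p∤d₂ p^k∣n₂ e₂) =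
    fraction _ _ (p∤-* p∤d₁ p∤d₂) (ℤD.∣m∣n⇒∣m+n (ℤD.∣m⇒∣m*n d₂ p^k∣n₁) (ℤD.∣m⇒∣m*n d₁ p^k∣n₂))
             (+-fraction q r n₁ d₁ n₂ d₂ e₁ e₂)

  ≤ᵥ-neg : ∀ {k q} → k ≤ᵥ q → k ≤ᵥ - q
  ≤ᵥ-neg {q = q} (fraction n d p∤d p^k∣n e) = fraction _ d p∤d (ℤD.∣m⇒∣-m p^k∣n) (neg-fraction q n d e)

  ≤ᵥ-- : ∀ {k q r} → k ≤ᵥ q → k ≤ᵥ r → k ≤ᵥ q - r
  ≤ᵥ-- v w = ≤ᵥ-+ v (≤ᵥ-neg w)

  ≤ᵥ-* : ∀ {k l q r} → k ≤ᵥ q → l ≤ᵥ r → k ℕ.+ l ≤ᵥ q * r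
  ≤ᵥ-* {k} {l} {q} {r} (fraction n₁ d₁ p∤d₁ p^k∣n₁ e₁) (fraction n₂ d₂ p∤d₂ p^l∣n₂ e₂) =
    fraction _ _ (p∤-* p∤d₁ p∤d₂) p^k+l∣n₁n₂ (*-fraction q r n₁ d₁ n₂ d₂ e₁ e₂)
    where
    p^k+l∣n₁n₂ : + (p ^ (k ℕ.+ l)) ∣ n₁ ℤ.* n₂
    p^k+l∣n₁n₂ = ∣ᵤ⇒∣ (subst₂ ℕD._∣_ (sym (ℕP.^-distribˡ-+-* p k l)) (sym (ℤP.abs-* n₁ n₂))
                                      (ℕD.*-pres-∣ (∣⇒∣ᵤ p^k∣n₁) (∣⇒∣ᵤ p^l∣n₂)))

  ≤ᵥ-*ʳ : ∀ {k q r} → k ≤ᵥ q → 0 ≤ᵥ r → k ≤ᵥ q * r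
  ≤ᵥ-*ʳ {k} v w = subst (_≤ᵥ _) (ℕP.+-identityʳ k) (≤ᵥ-* v w)

  ≤ᵥ-weaken : ∀ {k l q} → k ≤ l → l ≤ᵥ q → k ≤ᵥ q
  ≤ᵥ-weaken {k} {l} k≤l (fraction n d p∤d p^l∣n e) = fraction n d p∤d (ℤD.∣-trans (∣ᵤ⇒∣ (^-monoʳ-∣ p k≤l)) p^l∣n) e

  0≤ᵥ-poch : ∀ {u} k → 0 ≤ᵥ u → 0 ≤ᵥ poch u k
  0≤ᵥ-poch zero    v = 0≤ᵥfromℤ (+ 1)
  0≤ᵥ-poch (suc k) v = ≤ᵥ-* (0≤ᵥ-poch k v) (≤ᵥ-+ v (0≤ᵥℚℕ k))

  record IsUnitℚ (q : ℚ) : Set where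
    constructor unit-fraction
    field
      num den   : ℤ
      p∤num     : p∤ num
      p∤den     : p∤ den
      q*den≡num : q * fromℤ den ≡ fromℤ num

  IsUnitℚ-fromℤ : ∀ {n} → p∤ n → IsUnitℚ (fromℤ n)
  IsUnitℚ-fromℤ {n} p∤n = unit-fraction n (+ 1) p∤n p∤1 (ℚP.*-identityʳ (fromℤ n))

  IsUnitℚ⇒0≤ᵥ : ∀ {q} → IsUnitℚ q → 0 ≤ᵥ q
  IsUnitℚ⇒0≤ᵥ (unit-fraction n d _ p∤d e) = fraction n d p∤d (∣ᵤ⇒∣ (ℕD.1∣ _)) e

  IsUnitℚ-* : ∀ {q r} → IsUnitℚ q → IsUnitℚ r → IsUnitℚ (q * r)
  IsUnitℚ-* {q} {r} (unit-fraction n₁ d₁ p∤n₁ p∤d₁ e₁) (unit-fraction n₂ d₂ p∤n₂ p∤d₂ e₂) =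
    unit-fraction _ _ (p∤-* p∤n₁ p∤n₂) (p∤-* p∤d₁ p∤d₂) (*-fraction q r n₁ d₁ n₂ d₂ e₁ e₂)

  IsUnitℚ⇒≢0 : ∀ {q} → IsUnitℚ q → q ≢ 0ℚ
  IsUnitℚ⇒≢0 {q} (unit-fraction n d p∤n _ e) refl =
    p∤n (subst (+ p ∣_) (fromℤ-injective {+ 0} (trans (sym (ℚP.*-zeroˡ (fromℤ d))) e)) (∣ᵤ⇒∣ (p ℕD.∣0)))

  IsUnitℚ⇒¬1≤ᵥ : ∀ {q} → IsUnitℚ q → ¬ (1 ≤ᵥ q)
  IsUnitℚ⇒¬1≤ᵥ {q} (unit-fraction n d p∤n p∤d e) (fraction n₁ d₁ p∤d₁ p^1∣n₁ e₁) =
    p∤n (p∣*-p∤⇒p∣ (subst (+ p ∣_) (sym nd₁≡n₁d) (ℤD.∣m⇒∣m*n d p∣n₁)) p∤d₁)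
    where
    p∣n₁ : + p ∣ n₁
    p∣n₁ = subst (λ t → + t ∣ n₁) (ℕP.*-identityʳ p) p^1∣n₁
    nd₁≡n₁d : n ℤ.* d₁ ≡ n₁ ℤ.* d
    nd₁≡n₁d = fromℤ-injective (begin
      fromℤ (n ℤ.* d₁)             ≡⟨ fromℤ-* n d₁ ⟩
      fromℤ n * fromℤ d₁           ≡⟨ cong (_* fromℤ d₁) (sym e) ⟩
      (q * fromℤ d) * fromℤ d₁     ≡⟨ solve 3 (λ q a b → (q :* a) :* b := (q :* b) :* a) refl q (fromℤ d) (fromℤ d₁) ⟩
      (q * fromℤ d₁) * fromℤ d     ≡⟨ cong (_* fromℤ d) e₁ ⟩
      fromℤ n₁ * fromℤ d           ≡⟨ sym (fromℤ-* n₁ d) ⟩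
      fromℤ (n₁ ℤ.* d)             ∎)
      where open ≡-Reasoning

  IsUnitℚ-close : ∀ {x y} → 0 ≤ᵥ x → 1 ≤ᵥ x - y → IsUnitℚ y → IsUnitℚ x
  IsUnitℚ-close {x} {y} (fraction n d p∤d _ e) 1≤ᵥx-y y-unit = unit-fraction n d p∤n p∤d e
    where
    p∤n : p∤ n
    p∤n p∣n = IsUnitℚ⇒¬1≤ᵥ y-unit (subst (1 ≤ᵥ_) (solve 2 (λ x y → x :- (x :- y) := y) refl x y) (≤ᵥ-- 1≤ᵥx 1≤ᵥx-y))
      where
      1≤ᵥx : 1 ≤ᵥ x
      1≤ᵥx = fraction n d p∤d (subst (λ t → + t ∣ n) (sym (ℕP.*-identityʳ p)) p∣n) e

  ≤ᵥ-÷' : ∀ {k x y} → k ≤ᵥ x → IsUnitℚ y → k ≤ᵥ x ÷' y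
  ≤ᵥ-÷' {x = x} {y} (fraction n₁ d₁ p∤d₁ p^k∣n₁ e₁) y-unit@(unit-fraction n₂ d₂ p∤n₂ _ e₂) =
    fraction _ _ (p∤-* p∤d₁ p∤n₂) (ℤD.∣m⇒∣m*n d₂ p^k∣n₁) (÷'-fraction x y n₁ d₁ n₂ d₂ e₁ e₂ (IsUnitℚ⇒≢0 y-unit))

  infix 4 _≈_
  record _≈_ (x y : ℚ) : Set where
    constructor 2≤ᵥ⇒≈
    field ≈⇒2≤ᵥ : 2 ≤ᵥ x - y
  open _≈_ public

  ≈-reflexive : ∀ {x y} → x ≡ y → x ≈ y
  ≈-reflexive {x} refl = 2≤ᵥ⇒≈ (subst (2 ≤ᵥ_) (sym (ℚP.+-inverseʳ x)) ≤ᵥ-0ℚ)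

  ≈-refl : ∀ {x} → x ≈ x
  ≈-refl = ≈-reflexive refl

  ≈-sym : ∀ {x y} → x ≈ y → y ≈ x
  ≈-sym {x} {y} (2≤ᵥ⇒≈ v) = 2≤ᵥ⇒≈ (subst (2 ≤ᵥ_) (solve 2 (λ x y → :- (x :- y) := y :- x) refl x y) (≤ᵥ-neg v))

  ≈-trans : ∀ {x y z} → x ≈ y → y ≈ z → x ≈ z
  ≈-trans {x} {y} {z} (2≤ᵥ⇒≈ v) (2≤ᵥ⇒≈ w) =
    2≤ᵥ⇒≈ (subst (2 ≤ᵥ_) (solve 3 (λ x y z → (x :- y) :+ (y :- z) := x :- z) refl x y z) (≤ᵥ-+ v w))

  ≈-+ : ∀ {x x′ y y′} → x ≈ x′ → y ≈ y′ → x + y ≈ x′ + y′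
  ≈-+ {x} {x′} {y} {y′} (2≤ᵥ⇒≈ v) (2≤ᵥ⇒≈ w) =
    2≤ᵥ⇒≈ (subst (2 ≤ᵥ_) (solve 4 (λ x a y b → (x :- a) :+ (y :- b) := (x :+ y) :- (a :+ b)) refl x x′ y y′) (≤ᵥ-+ v w))

  ≈-* : ∀ {x x′ y y′} → x ≈ x′ → y ≈ y′ → 0 ≤ᵥ x′ → 0 ≤ᵥ y → x * y ≈ x′ * y′
  ≈-* {x} {x′} {y} {y′} (2≤ᵥ⇒≈ v) (2≤ᵥ⇒≈ w) 0≤ᵥx′ 0≤ᵥy =
    2≤ᵥ⇒≈ (subst (2 ≤ᵥ_) (solve 4 (λ x a y b → (x :- a) :* y :+ a :* (y :- b) := x :* y :- a :* b) refl x x′ y y′)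
                 (≤ᵥ-+ (≤ᵥ-*ʳ v 0≤ᵥy) (≤ᵥ-* 0≤ᵥx′ w)))

  ≈-poch : ∀ {u v} k → u ≈ v → 0 ≤ᵥ u → 0 ≤ᵥ v → poch u k ≈ poch v k
  ≈-poch zero    _   _    _    = ≈-refl
  ≈-poch (suc k) u≈v 0≤ᵥu 0≤ᵥv =
    ≈-* (≈-poch k u≈v 0≤ᵥu 0≤ᵥv) (≈-+ u≈v ≈-refl) (0≤ᵥ-poch k 0≤ᵥv) (≤ᵥ-+ 0≤ᵥu (0≤ᵥℚℕ k))

  ≈-÷' : ∀ {n n′ d d′} → n ≈ n′ → d ≈ d′ → 0 ≤ᵥ n′ → IsUnitℚ d → IsUnitℚ d′ → n ÷' d ≈ n′ ÷' d′
  ≈-÷' {n} {n′} {d} {d′} (2≤ᵥ⇒≈ v) (2≤ᵥ⇒≈ w) 0≤ᵥn′ d-unit d′-unit =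
    2≤ᵥ⇒≈ (subst (2 ≤ᵥ_) eq (≤ᵥ-*ʳ (≤ᵥ-+ (≤ᵥ-*ʳ v (IsUnitℚ⇒0≤ᵥ d′-unit)) (≤ᵥ-neg (≤ᵥ-* 0≤ᵥn′ w)))
                                   (≤ᵥ-* (≤ᵥ-÷' (0≤ᵥfromℤ (+ 1)) d-unit) (≤ᵥ-÷' (0≤ᵥfromℤ (+ 1)) d′-unit))))
    where
    open ≡-Reasoning
    u = 1ℚ ÷' d
    u′ = 1ℚ ÷' d′
    eq : ((n - n′) * d′ + - (n′ * (d - d′))) * (u * u′) ≡ n ÷' d - n′ ÷' d′
    eq = begin
      ((n - n′) * d′ + - (n′ * (d - d′))) * (u * u′)
        ≡⟨ solve 6 (λ n a d b u v → ((n :- a) :* b :+ :- (a :* (d :- b))) :* (u :* v) := n :* u :* (b :* v) :- a :* v :* (d :* u)) refl n n′ d d′ u u′ ⟩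
      n * u * (d′ * u′) - n′ * u′ * (d * u)
        ≡⟨ cong₂ (λ s t → n * u * s - n′ * u′ * t) (÷'-inverseʳ d′ (IsUnitℚ⇒≢0 d′-unit)) (÷'-inverseʳ d (IsUnitℚ⇒≢0 d-unit)) ⟩
      n * u * 1ℚ - n′ * u′ * 1ℚ
        ≡⟨ cong₂ _-_ (trans (ℚP.*-identityʳ (n * u)) (sym (÷'≡*1÷' n d))) (trans (ℚP.*-identityʳ (n′ * u′)) (sym (÷'≡*1÷' n′ d′))) ⟩
      n ÷' d - n′ ÷' d′ ∎

  ≈⇒CongQ : ∀ {x y} → x ≈ y → CongQ p 2 x y
  ≈⇒CongQ {x} {y} (2≤ᵥ⇒≈ (fraction n d p∤d p²∣n q*d≡n)) = ∣⇒∣ᵤ p²∣↥q , λ p∣↧q → p∤↧q (∣ᵤ⇒∣ p∣↧q)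
    where
    q = x - y
    ↥q*d≡n*↧q : ↥ q ℤ.* d ≡ n ℤ.* ↧ q
    ↥q*d≡n*↧q = *-fromℤ⇒↥*≡*↧ q d n q*d≡n
    p^k∣↥q : ∀ k → + (p ^ k) ∣ n → + (p ^ k) ∣ ↥ q
    p^k∣↥q k p^k∣n = p^∣*-p∤⇒p^∣ k (subst (+ (p ^ k) ∣_) (sym ↥q*d≡n*↧q) (ℤD.∣m⇒∣m*n (↧ q) p^k∣n)) p∤d
    p²∣↥q : + (p ^ 2) ∣ ↥ q
    p²∣↥q = p^k∣↥q 2 p²∣n
    p∤↧q : p∤ (↧ q)
    p∤↧q p∣↧q = ℕP.<⇒≢ 1<p (sym (↥-↧-coprime q (∣⇒∣ᵤ p∣↥q , ∣⇒∣ᵤ p∣↧q)))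
      where
      p∣↥q : + p ∣ ↥ q
      p∣↥q = p∣*-p∤⇒p∣ (subst (+ p ∣_) (sym ↥q*d≡n*↧q) (ℤD.∣n⇒∣m*n n p∣↧q)) p∤d


  ≈-setoid : Setoid 0ℓ 0ℓ
  ≈-setoid = record
    { Carrier = ℚ ; _≈_ = _≈_
    ; isEquivalence = record { refl = ≈-refl ; sym = ≈-sym ; trans = ≈-trans }
    }

  p∣⇒1≤ᵥℚℕ : ∀ {n} → p ℕD.∣ n → 1 ≤ᵥ ℚℕ n
  p∣⇒1≤ᵥℚℕ {n} p∣n = p^∣⇒≤ᵥℚℕ (subst (ℕD._∣ n) (sym (ℕP.*-identityʳ p)) p∣n)

  IsUnitℚ-fact : ∀ k → k < p → IsUnitℚ (fact k)
  IsUnitℚ-fact k k<p = IsUnitℚ-fromℤ (p∤k! k k<p)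
    where
    p∤k! : ∀ k → k < p → p∤ (+ (k ℕ.!))
    p∤k! zero    _   = p∤1
    p∤k! (suc k) k<p = subst p∤_ (sym (ℤP.pos-* (suc k) (k ℕ.!)))
      (p∤-* {+ suc k} {+ (k ℕ.!)} (λ p∣1+k → ℕP.<⇒≱ k<p (ℕD.∣⇒≤ (∣⇒∣ᵤ p∣1+k))) (p∤k! k (ℕP.<-trans (ℕP.n<1+n k) k<p)))

module _ where
  open import Data.Rational using (_+_; _*_; _-_; -_)
  open ℚSolver.+-*-Solver
  open ≡-Reasoning

  Σ≤ : (ℕ → ℚ) → ℕ → ℚ
  Σ≤ f zero    = f 0
  Σ≤ f (suc n) = Σ≤ f n + f (suc n)

  Σ≤-cong : ∀ {f g} n → (∀ k → k ≤ n → f k ≡ g k) → Σ≤ f n ≡ Σ≤ g n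
  Σ≤-cong zero    f≡g = f≡g 0 z≤n
  Σ≤-cong (suc n) f≡g = cong₂ _+_ (Σ≤-cong n (λ k k≤n → f≡g k (ℕP.m≤n⇒m≤1+n k≤n))) (f≡g (suc n) ℕP.≤-refl)

  Σ≤-- : ∀ f g n → Σ≤ (λ k → f k - g k) n ≡ Σ≤ f n - Σ≤ g n
  Σ≤-- f g zero    = refl
  Σ≤-- f g (suc n) = trans (cong (_+ (f (suc n) - g (suc n))) (Σ≤-- f g n))
    (solve 4 (λ a b c d → (a :- b) :+ (c :- d) := (a :+ c) :- (b :+ d)) refl (Σ≤ f n) (Σ≤ g n) (f (suc n)) (g (suc n)))

  Σ≤-*ˡ : ∀ c f n → Σ≤ (λ k → c * f k) n ≡ c * Σ≤ f n
  Σ≤-*ˡ c f zero    = refl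
  Σ≤-*ˡ c f (suc n) = trans (cong (_+ (c * f (suc n))) (Σ≤-*ˡ c f n))
    (solve 3 (λ c a b → c :* a :+ c :* b := c :* (a :+ b)) refl c (Σ≤ f n) (f (suc n)))

  Σ≤-suc : ∀ f n → Σ≤ f (suc n) ≡ f 0 + Σ≤ (λ k → f (suc k)) n
  Σ≤-suc f zero    = refl
  Σ≤-suc f (suc n) = trans (cong (_+ f (suc (suc n))) (Σ≤-suc f n))
    (ℚP.+-assoc (f 0) (Σ≤ (λ k → f (suc k)) n) (f (suc (suc n))))

  Σ≤-vanishing-tail : ∀ f a c → a ≤ c → (∀ k → a < k → f k ≡ 0ℚ) → Σ≤ f c ≡ Σ≤ f a
  Σ≤-vanishing-tail f a zero    z≤n _ = refl
  Σ≤-vanishing-tail f a (suc c) a≤1+c f≡0 with ℕP.m≤n⇒m<n∨m≡n a≤1+c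
  ... | inj₂ refl      = refl
  ... | inj₁ (s≤s a≤c) = trans (cong₂ _+_ (Σ≤-vanishing-tail f a c a≤c f≡0) (f≡0 (suc c) (s≤s a≤c)))
                               (ℚP.+-identityʳ (Σ≤ f a))

  poch-+ : ∀ x i j → poch x (i ℕ.+ j) ≡ poch x i * poch (x + ℚℕ i) j
  poch-+ x i zero    = trans (cong (poch x) (ℕP.+-identityʳ i)) (sym (ℚP.*-identityʳ (poch x i)))
  poch-+ x i (suc j) = begin
    poch x (i ℕ.+ suc j)                                  ≡⟨ cong (poch x) (ℕP.+-suc i j) ⟩
    poch x (i ℕ.+ j) * (x + ℚℕ (i ℕ.+ j))                 ≡⟨ cong₂ _*_ (poch-+ x i j) (cong (λ t → x + t) (ℚℕ-+ i j)) ⟩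
    (poch x i * poch (x + ℚℕ i) j) * (x + (ℚℕ i + ℚℕ j)) ≡⟨ solve 5 (λ a b x u v → (a :* b) :* (x :+ (u :+ v)) := a :* (b :* ((x :+ u) :+ v))) refl (poch x i) (poch (x + ℚℕ i) j) x (ℚℕ i) (ℚℕ j) ⟩
    poch x i * (poch (x + ℚℕ i) j * ((x + ℚℕ i) + ℚℕ j)) ∎

  poch-suc : ∀ x k → poch x (suc k) ≡ x * poch (x + 1ℚ) k
  poch-suc x k = trans (poch-+ x 1 k) (cong (_* poch (x + 1ℚ) k) (trans (ℚP.*-identityˡ (x + 0ℚ)) (ℚP.+-identityʳ x)))

  poch-neg-vanishing : ∀ a k → a < k → poch (- ℚℕ a) k ≡ 0ℚ
  poch-neg-vanishing a k a<k = begin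
    poch (- ℚℕ a) k                               ≡⟨ cong (poch (- ℚℕ a)) (sym (ℕP.m+[n∸m]≡n a<k)) ⟩
    poch (- ℚℕ a) (suc a ℕ.+ j)                   ≡⟨ poch-+ (- ℚℕ a) (suc a) j ⟩
    (poch (- ℚℕ a) a * (- ℚℕ a + ℚℕ a)) * rest    ≡⟨ cong (λ t → (poch (- ℚℕ a) a * t) * rest) (ℚP.+-inverseˡ (ℚℕ a)) ⟩
    (poch (- ℚℕ a) a * 0ℚ) * rest                 ≡⟨ cong (_* rest) (ℚP.*-zeroʳ (poch (- ℚℕ a) a)) ⟩
    0ℚ * rest                                     ≡⟨ ℚP.*-zeroˡ rest ⟩
    0ℚ                                            ∎
    where
    j = k ∸ suc a
    rest = poch (- ℚℕ a + ℚℕ (suc a)) j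

  fact≢0 : ∀ k → fact k ≢ 0ℚ
  fact≢0 k k!≡0 = ℕ.≢-nonZero⁻¹ (k ℕ.!) {{k ℕP.!≢0}} (ℤP.+-injective (fromℤ-injective k!≡0))

  fact-suc : ∀ k → fact (suc k) ≡ fact k * ℚℕ (suc k)
  fact-suc k = trans (ℚℕ-* (suc k) (k ℕ.!)) (ℚP.*-comm (ℚℕ (suc k)) (fact k))

  1÷'fact : ℕ → ℚ
  1÷'fact k = 1ℚ ÷' fact k

  1÷'fact-suc : ∀ k → 1÷'fact k ≡ ℚℕ (suc k) * 1÷'fact (suc k)
  1÷'fact-suc k = sym (*≡1⇒≡1÷' (fact k) (ℚℕ (suc k) * 1÷'fact (suc k)) k!·[k+1]/[k+1]!≡1 (fact≢0 k))
    where
    k!·[k+1]/[k+1]!≡1 : fact k * (ℚℕ (suc k) * 1÷'fact (suc k)) ≡ 1ℚ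
    k!·[k+1]/[k+1]!≡1 = begin
      fact k * (ℚℕ (suc k) * 1÷'fact (suc k))   ≡⟨ sym (ℚP.*-assoc (fact k) (ℚℕ (suc k)) (1÷'fact (suc k))) ⟩
      (fact k * ℚℕ (suc k)) * 1÷'fact (suc k)   ≡⟨ cong (_* 1÷'fact (suc k)) (sym (fact-suc k)) ⟩
      fact (suc k) * 1÷'fact (suc k)            ≡⟨ ÷'-inverseʳ (fact (suc k)) (fact≢0 (suc k)) ⟩
      1ℚ                                        ∎

  -- (-a)_k / k! = (-1)^k (a choose k)
  signedBinom : ℕ → ℕ → ℚ
  signedBinom a k = poch (- ℚℕ a) k * 1÷'fact k

  signedBinom-vanishing : ∀ a → signedBinom a (suc a) ≡ 0ℚ
  signedBinom-vanishing a =
    trans (cong (_* 1÷'fact (suc a)) (poch-neg-vanishing a (suc a) ℕP.≤-refl)) (ℚP.*-zeroˡ (1÷'fact (suc a)))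

  signedBinom-pascal : ∀ a k → signedBinom (suc a) (suc k) ≡ signedBinom a (suc k) - signedBinom a k
  signedBinom-pascal a k = begin
    poch (- ℚℕ (suc a)) (suc k) * I                  ≡⟨ cong (_* I) (poch-suc (- ℚℕ (suc a)) k) ⟩
    (- ℚℕ (suc a) * poch (- ℚℕ (suc a) + 1ℚ) k) * I  ≡⟨ cong₂ (λ s t → (- s * poch t k) * I) (ℚℕ-+ 1 a) -[1+a]+1≡-a ⟩
    (- (1ℚ + ℚℕ a) * P) * I                          ≡⟨ solve 4 (λ a k P I → (:- (con 1ℚ :+ a) :* P) :* I := P :* (:- a :+ k) :* I :- P :* ((con 1ℚ :+ k) :* I)) refl (ℚℕ a) (ℚℕ k) P I ⟩
    P * (- ℚℕ a + ℚℕ k) * I - P * ((1ℚ + ℚℕ k) * I)  ≡⟨ cong (λ t → P * (- ℚℕ a + ℚℕ k) * I - P * t) (trans (cong (_* I) (sym (ℚℕ-+ 1 k))) (sym (1÷'fact-suc k))) ⟩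
    P * (- ℚℕ a + ℚℕ k) * I - P * 1÷'fact k          ∎
    where
    P = poch (- ℚℕ a) k
    I = 1÷'fact (suc k)
    -[1+a]+1≡-a : - ℚℕ (suc a) + 1ℚ ≡ - ℚℕ a
    -[1+a]+1≡-a = trans (cong (λ t → - t + 1ℚ) (ℚℕ-+ 1 a)) (solve 1 (λ a → :- (con 1ℚ :+ a) :+ con 1ℚ := :- a) refl (ℚℕ a))

  chu-vandermonde : ∀ y a z → Σ≤ (λ k → signedBinom a k * (poch y k * poch (z + ℚℕ k) (a ∸ k))) a ≡ poch (z - y) a
  chu-vandermonde y zero    z = refl
  chu-vandermonde y (suc a) z = begin
    Σ≤ F (suc a)                                     ≡⟨ Σ≤-suc F a ⟩
    G 0 + Σ≤ (λ k → F (suc k)) a                     ≡⟨ cong (λ t → G 0 + t) (trans (Σ≤-cong a (λ k _ → pascal-split k)) (Σ≤-- G′ H a)) ⟩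
    G 0 + (Σ≤ G′ a - Σ≤ H a)                         ≡⟨ sym (ℚP.+-assoc (G 0) (Σ≤ G′ a) (- Σ≤ H a)) ⟩
    (G 0 + Σ≤ G′ a) - Σ≤ H a                         ≡⟨ cong (_- Σ≤ H a) reindex ⟩
    Σ≤ G a - Σ≤ H a                                  ≡⟨ sym (Σ≤-- G H a) ⟩
    Σ≤ (λ k → G k - H k) a                           ≡⟨ Σ≤-cong a G-H ⟩
    Σ≤ (λ k → (z - y) * F₊ k) a                      ≡⟨ Σ≤-*ˡ (z - y) F₊ a ⟩
    (z - y) * Σ≤ F₊ a                                ≡⟨ cong ((z - y) *_) (chu-vandermonde y a (z + 1ℚ)) ⟩
    (z - y) * poch ((z + 1ℚ) - y) a                  ≡⟨ cong (λ t → (z - y) * poch t a) (solve 2 (λ z y → (z :+ con 1ℚ) :- y := (z :- y) :+ con 1ℚ) refl z y) ⟩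
    (z - y) * poch ((z - y) + 1ℚ) a                  ≡⟨ sym (poch-suc (z - y) a) ⟩
    poch (z - y) (suc a)                             ∎
    where
    F G Q G′ H F₊ : ℕ → ℚ
    F k  = signedBinom (suc a) k * (poch y k * poch (z + ℚℕ k) (suc a ∸ k))
    G k  = signedBinom a k * (poch y k * poch (z + ℚℕ k) (suc a ∸ k))
    Q k  = poch y (suc k) * poch (z + ℚℕ (suc k)) (a ∸ k)
    G′ k = signedBinom a (suc k) * Q k
    H k  = signedBinom a k * Q k
    F₊ k = signedBinom a k * (poch y k * poch ((z + 1ℚ) + ℚℕ k) (a ∸ k))

    pascal-split : ∀ k → F (suc k) ≡ G′ k - H k
    pascal-split k = trans (cong (_* Q k) (signedBinom-pascal a k))
      (solve 3 (λ u v q → (u :- v) :* q := u :* q :- v :* q) refl (signedBinom a (suc k)) (signedBinom a k) (Q k))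

    reindex : G 0 + Σ≤ G′ a ≡ Σ≤ G a
    reindex = begin
      G 0 + Σ≤ G′ a       ≡⟨ sym (Σ≤-suc G a) ⟩
      Σ≤ G a + G (suc a)  ≡⟨ cong (λ t → Σ≤ G a + t) (trans (cong (_* T) (signedBinom-vanishing a)) (ℚP.*-zeroˡ T)) ⟩
      Σ≤ G a + 0ℚ         ≡⟨ ℚP.+-identityʳ (Σ≤ G a) ⟩
      Σ≤ G a              ∎
      where T = poch y (suc a) * poch (z + ℚℕ (suc a)) (a ∸ a)

    G-H : ∀ k → k ≤ a → G k - H k ≡ (z - y) * F₊ k
    G-H k k≤a = begin
      E * (P * poch (z + ℚℕ k) (suc a ∸ k)) - E * ((P * (y + ℚℕ k)) * poch (z + ℚℕ (suc k)) (a ∸ k))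
        ≡⟨ cong₂ (λ s t → E * (P * s) - E * ((P * (y + ℚℕ k)) * t))
             (trans (cong (poch (z + ℚℕ k)) (ℕP.+-∸-assoc 1 k≤a)) (poch-suc (z + ℚℕ k) (a ∸ k)))
             (cong (λ t → poch t (a ∸ k)) (trans (cong (λ t → z + t) (ℚℕ-+ 1 k)) (solve 2 (λ z k → z :+ (con 1ℚ :+ k) := (z :+ k) :+ con 1ℚ) refl z (ℚℕ k)))) ⟩
      E * (P * ((z + ℚℕ k) * R)) - E * ((P * (y + ℚℕ k)) * R)
        ≡⟨ solve 6 (λ E P z k y R → E :* (P :* ((z :+ k) :* R)) :- E :* ((P :* (y :+ k)) :* R) := (z :- y) :* (E :* (P :* R))) refl E P z (ℚℕ k) y R ⟩
      (z - y) * (E * (P * R))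
        ≡⟨ cong (λ t → (z - y) * (E * (P * poch t (a ∸ k)))) (solve 2 (λ z k → (z :+ k) :+ con 1ℚ := (z :+ con 1ℚ) :+ k) refl z (ℚℕ k)) ⟩
      (z - y) * F₊ k ∎
      where
      E = signedBinom a k
      P = poch y k
      R = poch ((z + ℚℕ k) + 1ℚ) (a ∸ k)

  F21-term : ℚ → ℚ → ℚ → ℕ → ℚ
  F21-term x y z k = poch x k * poch y k * (1ℚ ÷' (poch z k * fact k))

  F21-1≡Σ≤ : ∀ x y z n → F21-1 x y z n ≡ Σ≤ (F21-term x y z) n
  F21-1≡Σ≤ x y z zero    = refl
  F21-1≡Σ≤ x y z (suc n) =
    cong₂ _+_ (F21-1≡Σ≤ x y z n) (÷'≡*1÷' (poch x (suc n) * poch y (suc n)) (poch z (suc n) * fact (suc n)))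

  F21-terminating : ∀ a c y z → a ≤ c → (∀ k → k ≤ a → poch z k ≢ 0ℚ) →
                    Σ≤ (F21-term (- ℚℕ a) y z) c * poch z a ≡ poch (z - y) a
  F21-terminating a c y z a≤c poch-z≢0 = begin
    Σ≤ (F21-term (- ℚℕ a) y z) c * poch z a             ≡⟨ cong (_* poch z a) (Σ≤-vanishing-tail _ a c a≤c term-vanishing) ⟩
    Σ≤ (F21-term (- ℚℕ a) y z) a * poch z a             ≡⟨ ℚP.*-comm _ (poch z a) ⟩
    poch z a * Σ≤ (F21-term (- ℚℕ a) y z) a             ≡⟨ sym (Σ≤-*ˡ (poch z a) _ a) ⟩
    Σ≤ (λ k → poch z a * F21-term (- ℚℕ a) y z k) a     ≡⟨ Σ≤-cong a clear-denominator ⟩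
    Σ≤ (λ k → signedBinom a k * (poch y k * poch (z + ℚℕ k) (a ∸ k))) a ≡⟨ chu-vandermonde y a z ⟩
    poch (z - y) a                                       ∎
    where
    term-vanishing : ∀ k → a < k → F21-term (- ℚℕ a) y z k ≡ 0ℚ
    term-vanishing k a<k = begin
      poch (- ℚℕ a) k * poch y k * W    ≡⟨ cong (λ t → t * poch y k * W) (poch-neg-vanishing a k a<k) ⟩
      0ℚ * poch y k * W                 ≡⟨ cong (_* W) (ℚP.*-zeroˡ (poch y k)) ⟩
      0ℚ * W                            ≡⟨ ℚP.*-zeroˡ W ⟩
      0ℚ                                ∎
      where W = 1ℚ ÷' (poch z k * fact k)

    W*poch≡1÷'fact : ∀ k → k ≤ a → (1ℚ ÷' (poch z k * fact k)) * poch z k ≡ 1÷'fact k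
    W*poch≡1÷'fact k k≤a = *≡1⇒≡1÷' (fact k) (W * poch z k) (begin
      fact k * (W * poch z k)   ≡⟨ solve 3 (λ f w u → f :* (w :* u) := (u :* f) :* w) refl (fact k) W (poch z k) ⟩
      (poch z k * fact k) * W   ≡⟨ ÷'-inverseʳ (poch z k * fact k) (*≢0 (poch-z≢0 k k≤a) (fact≢0 k)) ⟩
      1ℚ                        ∎) (fact≢0 k)
      where W = 1ℚ ÷' (poch z k * fact k)

    clear-denominator : ∀ k → k ≤ a → poch z a * F21-term (- ℚℕ a) y z k ≡ signedBinom a k * (poch y k * poch (z + ℚℕ k) (a ∸ k))
    clear-denominator k k≤a = begin
      poch z a * (N * Y * W)                                  ≡⟨ cong (λ t → poch z t * (N * Y * W)) (sym (ℕP.m+[n∸m]≡n k≤a)) ⟩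
      poch z (k ℕ.+ (a ∸ k)) * (N * Y * W)                    ≡⟨ cong (_* (N * Y * W)) (poch-+ z k (a ∸ k)) ⟩
      (poch z k * R) * (N * Y * W)                            ≡⟨ solve 5 (λ u r P Y w → (u :* r) :* (P :* Y :* w) := (P :* (w :* u)) :* (Y :* r)) refl (poch z k) R N Y W ⟩
      (N * (W * poch z k)) * (Y * R)                          ≡⟨ cong (λ t → (N * t) * (Y * R)) (W*poch≡1÷'fact k k≤a) ⟩
      signedBinom a k * (Y * R)                               ∎
      where
      N = poch (- ℚℕ a) k
      Y = poch y k
      W = 1ℚ ÷' (poch z k * fact k)
      R = poch (z + ℚℕ k) (a ∸ k)

  closedForm-den : ℚ → ℕ → ℕ → ℚ → ℚ → ℚ
  closedForm-den z c m′ x y = poch z c * poch (z - x - y) m′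

  closedForm-num : ℚ → ℕ → ℕ → ℕ → ℕ → ℚ → ℚ → ℚ
  closedForm-num z c a b m x y = poch (z - x) (c ∸ a) * poch (z - y) (c ∸ b) * poch (z - x - y - ℚℕ m) m

  F21-closedForm-at-neg : ∀ a b c m m′ y z → a ≤ c → a ℕ.+ m′ ≡ (c ∸ b) ℕ.+ m → m ≡ 0 ⊎ m′ ≡ 0 →
                          (∀ k → k ≤ a → poch z k ≢ 0ℚ) →
                          Σ≤ (F21-term (- ℚℕ a) y z) c * closedForm-den z c m′ (- ℚℕ a) y ≡ closedForm-num z c a b m (- ℚℕ a) y
  F21-closedForm-at-neg a b c m m′ y z a≤c a+m′≡c-b+m m≡0⊎m′≡0 poch-z≢0 = begin
    T * (poch z c * poch (z - - ℚℕ a - y) m′)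
      ≡⟨ cong (λ t → T * (t * poch (z - - ℚℕ a - y) m′)) (trans (cong (poch z) (sym (ℕP.m+[n∸m]≡n a≤c))) (poch-+ z a (c ∸ a))) ⟩
    T * ((poch z a * poch (z + ℚℕ a) (c ∸ a)) * poch (z - - ℚℕ a - y) m′)
      ≡⟨ solve 4 (λ T u r s → T :* ((u :* r) :* s) := (T :* u) :* (r :* s)) refl T (poch z a) (poch (z + ℚℕ a) (c ∸ a)) (poch (z - - ℚℕ a - y) m′) ⟩
    (T * poch z a) * (poch (z + ℚℕ a) (c ∸ a) * poch (z - - ℚℕ a - y) m′)
      ≡⟨ cong₂ (λ s t → s * (poch (z + ℚℕ a) (c ∸ a) * poch t m′)) (F21-terminating a c y z a≤c poch-z≢0)
               (solve 3 (λ z a y → z :- (:- a) :- y := (z :- y) :+ a) refl z (ℚℕ a) y) ⟩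
    poch (z - y) a * (poch (z + ℚℕ a) (c ∸ a) * poch ((z - y) + ℚℕ a) m′)
      ≡⟨ solve 3 (λ u r s → u :* (r :* s) := r :* (u :* s)) refl (poch (z - y) a) (poch (z + ℚℕ a) (c ∸ a)) (poch ((z - y) + ℚℕ a) m′) ⟩
    poch (z + ℚℕ a) (c ∸ a) * (poch (z - y) a * poch ((z - y) + ℚℕ a) m′)
      ≡⟨ cong (poch (z + ℚℕ a) (c ∸ a) *_) (trans (sym (poch-+ (z - y) a m′)) (trans (cong (poch (z - y)) a+m′≡c-b+m) (poch-+ (z - y) (c ∸ b) m))) ⟩
    poch (z + ℚℕ a) (c ∸ a) * (poch (z - y) (c ∸ b) * poch ((z - y) + ℚℕ (c ∸ b)) m)
      ≡⟨ cong₂ (λ s t → poch s (c ∸ a) * (poch (z - y) (c ∸ b) * t)) (solve 2 (λ z a → z :+ a := z :- (:- a)) refl z (ℚℕ a)) (last-factor m≡0⊎m′≡0) ⟩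
    poch (z - - ℚℕ a) (c ∸ a) * (poch (z - y) (c ∸ b) * poch (z - - ℚℕ a - y - ℚℕ m) m)
      ≡⟨ sym (ℚP.*-assoc (poch (z - - ℚℕ a) (c ∸ a)) (poch (z - y) (c ∸ b)) (poch (z - - ℚℕ a - y - ℚℕ m) m)) ⟩
    closedForm-num z c a b m (- ℚℕ a) y ∎
    where
    T = Σ≤ (F21-term (- ℚℕ a) y z) c
    last-factor : m ≡ 0 ⊎ m′ ≡ 0 → poch ((z - y) + ℚℕ (c ∸ b)) m ≡ poch (z - - ℚℕ a - y - ℚℕ m) m
    last-factor (inj₁ refl) = refl
    last-factor (inj₂ refl) = cong (λ t → poch t m) (begin
      (z - y) + ℚℕ (c ∸ b)                        ≡⟨ solve 4 (λ z y u m → (z :- y) :+ u := z :- (:- (u :+ m)) :- y :- m) refl z y (ℚℕ (c ∸ b)) (ℚℕ m) ⟩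
      z - - (ℚℕ (c ∸ b) + ℚℕ m) - y - ℚℕ m        ≡⟨ cong (λ t → z - - t - y - ℚℕ m) (trans (sym (ℚℕ-+ (c ∸ b) m)) (cong ℚℕ (trans (sym a+m′≡c-b+m) (ℕP.+-identityʳ a)))) ⟩
      z - - ℚℕ a - y - ℚℕ m                       ∎)

module Grid (p : ℕ) (p-prime : Prime p) (x₀ x₁ y₀ y₁ : ℚ) where
  open PAdic p p-prime
  open import Data.Rational using (_+_; _*_; _-_; -_)
  open ℚSolver.+-*-Solver

  -- Every polynomial with p-integral coefficients is Regular once x₁ ≡ x₀ and y₁ ≡ y₀ (mod p).
  record Regular (F : ℚ → ℚ → ℚ) : Set where
    field
      int₀₀ : 0 ≤ᵥ F x₀ y₀
      int₀₁ : 0 ≤ᵥ F x₀ y₁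
      int₁₀ : 0 ≤ᵥ F x₁ y₀
      int₁₁ : 0 ≤ᵥ F x₁ y₁
      Δx₀   : 1 ≤ᵥ F x₁ y₀ - F x₀ y₀
      Δx₁   : 1 ≤ᵥ F x₁ y₁ - F x₀ y₁
      Δy₀   : 1 ≤ᵥ F x₀ y₁ - F x₀ y₀
      Δy₁   : 1 ≤ᵥ F x₁ y₁ - F x₁ y₀
      Δxy   : 2 ≤ᵥ F x₁ y₁ - F x₀ y₁ - F x₁ y₀ + F x₀ y₀
  open Regular

  private
    ≤ᵥ-x-x : ∀ {k} c → k ≤ᵥ c - c
    ≤ᵥ-x-x c = subst (_ ≤ᵥ_) (sym (ℚP.+-inverseʳ c)) ≤ᵥ-0ℚ

  Regular-const : ∀ c → 0 ≤ᵥ c → Regular (λ _ _ → c)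
  Regular-const c 0≤ᵥc = record
    { int₀₀ = 0≤ᵥc ; int₀₁ = 0≤ᵥc ; int₁₀ = 0≤ᵥc ; int₁₁ = 0≤ᵥc
    ; Δx₀ = ≤ᵥ-x-x c ; Δx₁ = ≤ᵥ-x-x c ; Δy₀ = ≤ᵥ-x-x c ; Δy₁ = ≤ᵥ-x-x c
    ; Δxy = subst (2 ≤ᵥ_) (solve 1 (λ c → con 0ℚ := c :- c :- c :+ c) refl c) ≤ᵥ-0ℚ
    }

  Regular-x : 0 ≤ᵥ x₀ → 0 ≤ᵥ x₁ → 1 ≤ᵥ x₁ - x₀ → Regular (λ x _ → x)
  Regular-x 0≤ᵥx₀ 0≤ᵥx₁ 1≤ᵥx₁-x₀ = record
    { int₀₀ = 0≤ᵥx₀ ; int₀₁ = 0≤ᵥx₀ ; int₁₀ = 0≤ᵥx₁ ; int₁₁ = 0≤ᵥx₁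
    ; Δx₀ = 1≤ᵥx₁-x₀ ; Δx₁ = 1≤ᵥx₁-x₀ ; Δy₀ = ≤ᵥ-x-x x₀ ; Δy₁ = ≤ᵥ-x-x x₁
    ; Δxy = subst (2 ≤ᵥ_) (solve 2 (λ a b → con 0ℚ := b :- a :- b :+ a) refl x₀ x₁) ≤ᵥ-0ℚ
    }

  Regular-y : 0 ≤ᵥ y₀ → 0 ≤ᵥ y₁ → 1 ≤ᵥ y₁ - y₀ → Regular (λ _ y → y)
  Regular-y 0≤ᵥy₀ 0≤ᵥy₁ 1≤ᵥy₁-y₀ = record
    { int₀₀ = 0≤ᵥy₀ ; int₀₁ = 0≤ᵥy₁ ; int₁₀ = 0≤ᵥy₀ ; int₁₁ = 0≤ᵥy₁
    ; Δx₀ = ≤ᵥ-x-x y₀ ; Δx₁ = ≤ᵥ-x-x y₁ ; Δy₀ = 1≤ᵥy₁-y₀ ; Δy₁ = 1≤ᵥy₁-y₀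
    ; Δxy = subst (2 ≤ᵥ_) (solve 2 (λ a b → con 0ℚ := b :- b :- a :+ a) refl y₀ y₁) ≤ᵥ-0ℚ
    }

  Regular-+ : ∀ {F G} → Regular F → Regular G → Regular (λ x y → F x y + G x y)
  Regular-+ {F} {G} rF rG = record
    { int₀₀ = ≤ᵥ-+ (int₀₀ rF) (int₀₀ rG) ; int₀₁ = ≤ᵥ-+ (int₀₁ rF) (int₀₁ rG)
    ; int₁₀ = ≤ᵥ-+ (int₁₀ rF) (int₁₀ rG) ; int₁₁ = ≤ᵥ-+ (int₁₁ rF) (int₁₁ rG)
    ; Δx₀ = Δ-+ (F x₁ y₀) (F x₀ y₀) (G x₁ y₀) (G x₀ y₀) (Δx₀ rF) (Δx₀ rG)
    ; Δx₁ = Δ-+ (F x₁ y₁) (F x₀ y₁) (G x₁ y₁) (G x₀ y₁) (Δx₁ rF) (Δx₁ rG)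
    ; Δy₀ = Δ-+ (F x₀ y₁) (F x₀ y₀) (G x₀ y₁) (G x₀ y₀) (Δy₀ rF) (Δy₀ rG)
    ; Δy₁ = Δ-+ (F x₁ y₁) (F x₁ y₀) (G x₁ y₁) (G x₁ y₀) (Δy₁ rF) (Δy₁ rG)
    ; Δxy = subst (2 ≤ᵥ_)
        (solve 8 (λ a b c d e f g h → (a :- b :- c :+ d) :+ (e :- f :- g :+ h) := (a :+ e) :- (b :+ f) :- (c :+ g) :+ (d :+ h)) refl
           (F x₁ y₁) (F x₀ y₁) (F x₁ y₀) (F x₀ y₀) (G x₁ y₁) (G x₀ y₁) (G x₁ y₀) (G x₀ y₀))
        (≤ᵥ-+ (Δxy rF) (Δxy rG))
    }
    where
    Δ-+ : ∀ a b c d → 1 ≤ᵥ a - b → 1 ≤ᵥ c - d → 1 ≤ᵥ (a + c) - (b + d)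
    Δ-+ a b c d v w = subst (1 ≤ᵥ_) (solve 4 (λ a b c d → (a :- b) :+ (c :- d) := (a :+ c) :- (b :+ d)) refl a b c d) (≤ᵥ-+ v w)

  Regular-neg : ∀ {F} → Regular F → Regular (λ x y → - F x y)
  Regular-neg {F} rF = record
    { int₀₀ = ≤ᵥ-neg (int₀₀ rF) ; int₀₁ = ≤ᵥ-neg (int₀₁ rF) ; int₁₀ = ≤ᵥ-neg (int₁₀ rF) ; int₁₁ = ≤ᵥ-neg (int₁₁ rF)
    ; Δx₀ = Δ-neg (F x₁ y₀) (F x₀ y₀) (Δx₀ rF) ; Δx₁ = Δ-neg (F x₁ y₁) (F x₀ y₁) (Δx₁ rF)
    ; Δy₀ = Δ-neg (F x₀ y₁) (F x₀ y₀) (Δy₀ rF) ; Δy₁ = Δ-neg (F x₁ y₁) (F x₁ y₀) (Δy₁ rF)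
    ; Δxy = subst (2 ≤ᵥ_)
        (solve 4 (λ a b c d → :- (a :- b :- c :+ d) := (:- a) :- (:- b) :- (:- c) :+ (:- d)) refl (F x₁ y₁) (F x₀ y₁) (F x₁ y₀) (F x₀ y₀))
        (≤ᵥ-neg (Δxy rF))
    }
    where
    Δ-neg : ∀ a b → 1 ≤ᵥ a - b → 1 ≤ᵥ (- a) - (- b)
    Δ-neg a b v = subst (1 ≤ᵥ_) (solve 2 (λ a b → :- (a :- b) := (:- a) :- (:- b)) refl a b) (≤ᵥ-neg v)

  Regular-- : ∀ {F G} → Regular F → Regular G → Regular (λ x y → F x y - G x y)
  Regular-- rF rG = Regular-+ rF (Regular-neg rG)

  -- ab - a′b′ = (a - a′) b + a′ (b - b′); the mixed difference expands likewise into terms of valuation ≥ 2.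
  Regular-* : ∀ {F G} → Regular F → Regular G → Regular (λ x y → F x y * G x y)
  Regular-* {F} {G} rF rG = record
    { int₀₀ = ≤ᵥ-* (int₀₀ rF) (int₀₀ rG) ; int₀₁ = ≤ᵥ-* (int₀₁ rF) (int₀₁ rG)
    ; int₁₀ = ≤ᵥ-* (int₁₀ rF) (int₁₀ rG) ; int₁₁ = ≤ᵥ-* (int₁₁ rF) (int₁₁ rG)
    ; Δx₀ = Δ-* (F x₁ y₀) (F x₀ y₀) (G x₁ y₀) (G x₀ y₀) (Δx₀ rF) (Δx₀ rG) (int₁₀ rG) (int₀₀ rF)
    ; Δx₁ = Δ-* (F x₁ y₁) (F x₀ y₁) (G x₁ y₁) (G x₀ y₁) (Δx₁ rF) (Δx₁ rG) (int₁₁ rG) (int₀₁ rF)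
    ; Δy₀ = Δ-* (F x₀ y₁) (F x₀ y₀) (G x₀ y₁) (G x₀ y₀) (Δy₀ rF) (Δy₀ rG) (int₀₁ rG) (int₀₀ rF)
    ; Δy₁ = Δ-* (F x₁ y₁) (F x₁ y₀) (G x₁ y₁) (G x₁ y₀) (Δy₁ rF) (Δy₁ rG) (int₁₁ rG) (int₁₀ rF)
    ; Δxy = subst (2 ≤ᵥ_)
        (solve 8 (λ a b c e A B C E → (a :- b :- c :+ e) :* A :+ e :* (A :- B :- C :+ E) :+ (c :- e) :* (A :- C) :+ (b :- e) :* (A :- B)
                                    := a :* A :- b :* B :- c :* C :+ e :* E) refl
           (F x₁ y₁) (F x₀ y₁) (F x₁ y₀) (F x₀ y₀) (G x₁ y₁) (G x₀ y₁) (G x₁ y₀) (G x₀ y₀))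
        (≤ᵥ-+ (≤ᵥ-+ (≤ᵥ-+ (≤ᵥ-*ʳ (Δxy rF) (int₁₁ rG)) (≤ᵥ-* (int₀₀ rF) (Δxy rG))) (≤ᵥ-* (Δx₀ rF) (Δy₁ rG))) (≤ᵥ-* (Δy₀ rF) (Δx₁ rG)))
    }
    where
    Δ-* : ∀ a b c e → 1 ≤ᵥ a - b → 1 ≤ᵥ c - e → 0 ≤ᵥ c → 0 ≤ᵥ b → 1 ≤ᵥ a * c - b * e
    Δ-* a b c e v w 0≤ᵥc 0≤ᵥb =
      subst (1 ≤ᵥ_) (solve 4 (λ a b c e → (a :- b) :* c :+ b :* (c :- e) := a :* c :- b :* e) refl a b c e) (≤ᵥ-+ (≤ᵥ-*ʳ v 0≤ᵥc) (≤ᵥ-* 0≤ᵥb w))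

  Regular-poch : ∀ {F} k → Regular F → Regular (λ x y → poch (F x y) k)
  Regular-poch zero    rF = Regular-const 1ℚ (0≤ᵥfromℤ (+ 1))
  Regular-poch (suc k) rF = Regular-* (Regular-poch k rF) (Regular-+ rF (Regular-const (ℚℕ k) (0≤ᵥℚℕ k)))

  Regular-Σ≤ : ∀ {f : ℕ → ℚ → ℚ → ℚ} n → (∀ k → k ≤ n → Regular (f k)) → Regular (λ x y → Σ≤ (λ k → f k x y) n)
  Regular-Σ≤ zero    rf = rf 0 z≤n
  Regular-Σ≤ (suc n) rf = Regular-+ (Regular-Σ≤ n (λ k k≤n → rf k (ℕP.m≤n⇒m≤1+n k≤n))) (rf (suc n) ℕP.≤-refl)

  Regular-vanishing : ∀ {G} → Regular G → (∀ y → G x₀ y ≡ 0ℚ) → (∀ x → G x y₀ ≡ 0ℚ) → 2 ≤ᵥ G x₁ y₁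
  Regular-vanishing {G} rG G[x₀,-]≡0 G[-,y₀]≡0 = subst (2 ≤ᵥ_) Δxy≡G₁₁ (Δxy rG)
    where
    open ≡-Reasoning
    Δxy≡G₁₁ : G x₁ y₁ - G x₀ y₁ - G x₁ y₀ + G x₀ y₀ ≡ G x₁ y₁
    Δxy≡G₁₁ = begin
      G x₁ y₁ - G x₀ y₁ - G x₁ y₀ + G x₀ y₀ ≡⟨ cong₂ (λ s t → G x₁ y₁ - s - t + G x₀ y₀) (G[x₀,-]≡0 y₁) (G[-,y₀]≡0 x₁) ⟩
      G x₁ y₁ - 0ℚ - 0ℚ + G x₀ y₀           ≡⟨ cong (λ s → G x₁ y₁ - 0ℚ - 0ℚ + s) (G[x₀,-]≡0 y₀) ⟩
      G x₁ y₁ - 0ℚ - 0ℚ + 0ℚ                ≡⟨ solve 1 (λ g → g :- con 0ℚ :- con 0ℚ :+ con 0ℚ := g) refl (G x₁ y₁) ⟩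
      G x₁ y₁                               ∎

module _ where
  open ℤSolver.+-*-Solver
  open ≡-Reasoning

  sign : ℕ → ℤ
  sign zero          = + 1
  sign (suc zero)    = -[1+ 0 ]
  sign (suc (suc n)) = sign n

  sign-suc : ∀ n → sign (suc n) ≡ ℤ.- sign n
  sign-suc zero          = refl
  sign-suc (suc zero)    = refl
  sign-suc (suc (suc n)) = sign-suc n

  sign-+ : ∀ m n → sign (m ℕ.+ n) ≡ sign m ℤ.* sign n
  sign-+ zero          n = sym (ℤP.*-identityˡ (sign n))
  sign-+ (suc zero)    n = trans (sign-suc n) (sym (ℤP.-1*i≡-i (sign n)))
  sign-+ (suc (suc m)) n = sign-+ m n

  -- Defs computes the sign of Γₚℕ by a where-bound function, which cannot be named here (hence
  -- the type of hidden-sign is left to unification); abstracting its hidden parameter X lets the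
  -- recursion on its argument go through.
  mutual
    Γₚℕ≡sign*prodCoprime : ∀ p n → Γₚℕ p n ≡ sign n ℤ.* prodCoprime p n
    Γₚℕ≡sign*prodCoprime p zero          = refl
    Γₚℕ≡sign*prodCoprime p (suc zero)    = refl
    Γₚℕ≡sign*prodCoprime p (suc (suc k)) with prodCoprime p (suc (suc k)) | suc (suc k)
    ... | c | X = hidden-sign p X c k

    hidden-sign : ∀ (p X : ℕ) (c : ℤ) (j : ℕ) → _
    hidden-sign p X c zero          = refl
    hidden-sign p X c (suc zero)    = refl
    hidden-sign p X c (suc (suc j)) = hidden-sign p X c j

  rise : ℤ → ℕ → ℤ
  rise t zero    = + 1
  rise t (suc m) = rise t m ℤ.* (t ℤ.+ + m)

  rise-suc : ∀ t m → rise t (suc m) ≡ t ℤ.* rise (t ℤ.+ + 1) m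
  rise-suc t zero    = trans (ℤP.*-identityˡ (t ℤ.+ + 0)) (trans (ℤP.+-identityʳ t) (sym (ℤP.*-identityʳ t)))
  rise-suc t (suc m) = begin
    rise t (suc m) ℤ.* (t ℤ.+ + suc m)                     ≡⟨ cong₂ (λ s u → s ℤ.* (t ℤ.+ u)) (rise-suc t m) (ℤP.pos-+ 1 m) ⟩
    (t ℤ.* rise (t ℤ.+ + 1) m) ℤ.* (t ℤ.+ (+ 1 ℤ.+ + m))   ≡⟨ solve 4 (λ t R o m → (t :* R) :* (t :+ (o :+ m)) := t :* (R :* ((t :+ o) :+ m))) refl t (rise (t ℤ.+ + 1) m) (+ 1) (+ m) ⟩
    t ℤ.* (rise (t ℤ.+ + 1) m ℤ.* ((t ℤ.+ + 1) ℤ.+ + m))   ∎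

  rise-neg : ∀ m → rise (ℤ.- + m) m ≡ sign m ℤ.* rise (+ 1) m
  rise-neg zero    = refl
  rise-neg (suc m) = begin
    rise (ℤ.- + suc m) (suc m)                              ≡⟨ rise-suc (ℤ.- + suc m) m ⟩
    ℤ.- + suc m ℤ.* rise (ℤ.- + suc m ℤ.+ + 1) m            ≡⟨ cong₂ (λ s u → ℤ.- s ℤ.* rise (ℤ.- s ℤ.+ + 1) m) (ℤP.pos-+ 1 m) (sym (ℤP.pos-+ 1 m)) ⟩
    ℤ.- (+ 1 ℤ.+ + m) ℤ.* rise (ℤ.- (+ 1 ℤ.+ + m) ℤ.+ + 1) m ≡⟨ cong (λ s → ℤ.- (+ 1 ℤ.+ + m) ℤ.* rise s m) (solve 1 (λ m → :- (con (+ 1) :+ m) :+ con (+ 1) := :- m) refl (+ m)) ⟩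
    ℤ.- (+ 1 ℤ.+ + m) ℤ.* rise (ℤ.- + m) m                  ≡⟨ cong (ℤ.- (+ 1 ℤ.+ + m) ℤ.*_) (rise-neg m) ⟩
    ℤ.- (+ 1 ℤ.+ + m) ℤ.* (sign m ℤ.* rise (+ 1) m)         ≡⟨ solve 3 (λ m s R → :- (con (+ 1) :+ m) :* (s :* R) := (:- s) :* (R :* (con (+ 1) :+ m))) refl (+ m) (sign m) (rise (+ 1) m) ⟩
    ℤ.- sign m ℤ.* rise (+ 1) (suc m)                       ≡⟨ cong (ℤ._* rise (+ 1) (suc m)) (sym (sign-suc m)) ⟩
    sign (suc m) ℤ.* rise (+ 1) (suc m)                     ∎

  poch-fromℤ : ∀ t k → poch (fromℤ t) k ≡ fromℤ (rise t k)
  poch-fromℤ t zero    = refl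
  poch-fromℤ t (suc k) = trans (cong₂ ℚ._*_ (poch-fromℤ t k) (sym (fromℤ-+ t (+ k)))) (sym (fromℤ-* (rise t k) (t ℤ.+ + k)))

module Morita (p : ℕ) (p-prime : Prime p) where
  open PAdic p p-prime
  open ℤSolver.+-*-Solver
  open ≡-Reasoning

  infix 4 _≡ₚ²_
  record _≡ₚ²_ (a b : ℤ) : Set where
    constructor p²∣⇒≡ₚ²
    field ≡ₚ²⇒p²∣ : + (p ^ 2) ∣ a ℤ.- b
  open _≡ₚ²_ public

  ≡ₚ²-reflexive : ∀ {a b} → a ≡ b → a ≡ₚ² b
  ≡ₚ²-reflexive {a} refl = p²∣⇒≡ₚ² (subst (+ (p ^ 2) ∣_) (sym (ℤP.+-inverseʳ a)) (∣ᵤ⇒∣ ((p ^ 2) ℕD.∣0)))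

  ≡ₚ²-sym : ∀ {a b} → a ≡ₚ² b → b ≡ₚ² a
  ≡ₚ²-sym {a} {b} (p²∣⇒≡ₚ² d) = p²∣⇒≡ₚ² (subst (+ (p ^ 2) ∣_) (solve 2 (λ a b → :- (a :- b) := b :- a) refl a b) (ℤD.∣m⇒∣-m d))

  ≡ₚ²-trans : ∀ {a b c} → a ≡ₚ² b → b ≡ₚ² c → a ≡ₚ² c
  ≡ₚ²-trans {a} {b} {c} (p²∣⇒≡ₚ² d₁) (p²∣⇒≡ₚ² d₂) =
    p²∣⇒≡ₚ² (subst (+ (p ^ 2) ∣_) (solve 3 (λ a b c → (a :- b) :+ (b :- c) := a :- c) refl a b c) (ℤD.∣m∣n⇒∣m+n d₁ d₂))

  ≡ₚ²-* : ∀ {a b c d} → a ≡ₚ² b → c ≡ₚ² d → a ℤ.* c ≡ₚ² b ℤ.* d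
  ≡ₚ²-* {a} {b} {c} {d} (p²∣⇒≡ₚ² d₁) (p²∣⇒≡ₚ² d₂) =
    p²∣⇒≡ₚ² (subst (+ (p ^ 2) ∣_) (solve 4 (λ a b c d → a :* (c :- d) :+ (a :- b) :* d := a :* c :- b :* d) refl a b c d)
                   (ℤD.∣m∣n⇒∣m+n (ℤD.∣n⇒∣m*n a d₂) (ℤD.∣m⇒∣m*n d d₁)))

  ≡ₚ²-setoid : Setoid 0ℓ 0ℓ
  ≡ₚ²-setoid = record
    { Carrier = ℤ ; _≈_ = _≡ₚ²_
    ; isEquivalence = record { refl = ≡ₚ²-reflexive refl ; sym = ≡ₚ²-sym ; trans = ≡ₚ²-trans }
    }

  ≡ₚ²⇒≈ : ∀ {a b} → a ≡ₚ² b → fromℤ a ≈ fromℤ b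
  ≡ₚ²⇒≈ {a} {b} (p²∣⇒≡ₚ² p²∣a-b) = 2≤ᵥ⇒≈ (subst (2 ≤ᵥ_) (fromℤ-- a b) (≤ᵥ-fromℤ p²∣a-b))

  fromℤ-÷'-≈ : ∀ {a b c d} → p∤ b → p∤ d → a ℤ.* d ≡ₚ² c ℤ.* b → fromℤ a ÷' fromℤ b ≈ fromℤ c ÷' fromℤ d
  fromℤ-÷'-≈ {a} {b} {c} {d} p∤b p∤d ad≡cb =
    subst₂ _≈_ (÷'-*-cancelʳ (fromℤ a) (fromℤ b) (fromℤ d) (IsUnitℚ⇒≢0 d-unit))
               (÷'-*-cancelʳ (fromℤ c) (fromℤ d) (fromℤ b) (IsUnitℚ⇒≢0 b-unit))
      (≈-÷' (subst₂ _≈_ (fromℤ-* a d) (fromℤ-* c b) (≡ₚ²⇒≈ ad≡cb))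
            (≈-reflexive (ℚP.*-comm (fromℤ b) (fromℤ d)))
            (subst (0 ≤ᵥ_) (fromℤ-* c b) (0≤ᵥfromℤ (c ℤ.* b)))
            (IsUnitℚ-* b-unit d-unit) (IsUnitℚ-* d-unit b-unit))
    where
    b-unit = IsUnitℚ-fromℤ p∤b
    d-unit = IsUnitℚ-fromℤ p∤d

  UnitRun : ℕ → ℕ → Set
  UnitRun g m = ∀ i → i < m → ¬ (p ℕD.∣ g ℕ.+ i)

  UnitRun-below-multiple : ∀ g r → p ℕD.∣ g ℕ.+ r → r < p → UnitRun g r
  UnitRun-below-multiple g r p∣g+r r<p i i<r p∣g+i = ℕP.<⇒≱ (ℕP.≤-<-trans (ℕP.m∸n≤m r i) r<p) (ℕD.∣⇒≤ p∣r-i)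
    where
    instance _ = ℕ.≢-nonZero (λ r-i≡0 → ℕP.<⇒≢ (ℕP.m<n⇒0<n∸m i<r) (sym r-i≡0))
    g+r≡g+i+[r-i] : g ℕ.+ r ≡ g ℕ.+ i ℕ.+ (r ∸ i)
    g+r≡g+i+[r-i] = trans (cong (g ℕ.+_) (sym (ℕP.m+[n∸m]≡n (ℕP.<⇒≤ i<r)))) (sym (ℕP.+-assoc g i (r ∸ i)))
    p∣r-i : p ℕD.∣ r ∸ i
    p∣r-i = ℕD.∣m+n∣m⇒∣n (subst (p ℕD.∣_) g+r≡g+i+[r-i] p∣g+r) p∣g+i

  p∤rise : ∀ g m → UnitRun g m → p∤ rise (+ g) m
  p∤rise g zero    _   = p∤1
  p∤rise g (suc m) run = p∤-* (p∤rise g m (λ i i<m → run i (ℕP.m<n⇒m<1+n i<m)))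
                              (λ p∣g+m → run m ℕP.≤-refl (∣⇒∣ᵤ (subst (+ p ∣_) (sym (ℤP.pos-+ g m)) p∣g+m)))

  p∤sign : ∀ n → p∤ sign n
  p∤sign zero          = p∤1
  p∤sign (suc zero)    = λ p∣-1 → p∤1 (ℤD.∣m⇒∣-m p∣-1)
  p∤sign (suc (suc n)) = p∤sign n

  p∤prodCoprime : ∀ n → p∤ prodCoprime p n
  p∤prodCoprime zero = p∤1
  p∤prodCoprime (suc j) with p ℕD.∣? j
  ... | yes _   = p∤prodCoprime j
  ... | no  p∤j = p∤-* (p∤prodCoprime j) (λ p∣j → p∤j (∣⇒∣ᵤ p∣j))

  prodCoprime-suc-multiple : ∀ j → p ℕD.∣ j → prodCoprime p (suc j) ≡ prodCoprime p j
  prodCoprime-suc-multiple j p∣j with p ℕD.∣? j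
  ... | yes _   = refl
  ... | no  p∤j = ⊥-elim (p∤j p∣j)

  prodCoprime-+ : ∀ g m → UnitRun g m → prodCoprime p (g ℕ.+ m) ≡ prodCoprime p g ℤ.* rise (+ g) m
  prodCoprime-+ g zero    _   = trans (cong (prodCoprime p) (ℕP.+-identityʳ g)) (sym (ℤP.*-identityʳ (prodCoprime p g)))
  prodCoprime-+ g (suc m) run = begin
    prodCoprime p (g ℕ.+ suc m)                           ≡⟨ cong (prodCoprime p) (ℕP.+-suc g m) ⟩
    prodCoprime p (suc (g ℕ.+ m))                         ≡⟨ step ⟩
    prodCoprime p (g ℕ.+ m) ℤ.* (+ g ℤ.+ + m)             ≡⟨ cong (ℤ._* (+ g ℤ.+ + m)) (prodCoprime-+ g m (λ i i<m → run i (ℕP.m<n⇒m<1+n i<m))) ⟩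
    (prodCoprime p g ℤ.* rise (+ g) m) ℤ.* (+ g ℤ.+ + m)  ≡⟨ ℤP.*-assoc (prodCoprime p g) (rise (+ g) m) (+ g ℤ.+ + m) ⟩
    prodCoprime p g ℤ.* rise (+ g) (suc m)                ∎
    where
    step : prodCoprime p (suc (g ℕ.+ m)) ≡ prodCoprime p (g ℕ.+ m) ℤ.* (+ g ℤ.+ + m)
    step with p ℕD.∣? (g ℕ.+ m)
    ... | yes p∣g+m = ⊥-elim (run m ℕP.≤-refl p∣g+m)
    ... | no  _     = cong (prodCoprime p (g ℕ.+ m) ℤ.*_) (ℤP.pos-+ g m)

  -- The derivative at t = 0 of  rise (t + 1) m  =  (t + 1) ⋯ (t + m).
  rise-slope : ℕ → ℤ
  rise-slope zero    = + 0
  rise-slope (suc m) = rise-slope m ℤ.* (+ 1 ℤ.+ + m) ℤ.+ rise (+ 1) m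

  +p²≡+p*+p : + (p ^ 2) ≡ + p ℤ.* + p
  +p²≡+p*+p = trans (cong (λ n → + (p ℕ.* n)) (ℕP.*-identityʳ p)) (ℤP.pos-* p p)

  rise-linear : ∀ s m → rise (s ℤ.* + p ℤ.+ + 1) m ≡ₚ² rise (+ 1) m ℤ.+ s ℤ.* + p ℤ.* rise-slope m
  rise-linear s zero    = ≡ₚ²-reflexive (solve 2 (λ s P → con (+ 1) := con (+ 1) :+ s :* P :* con (+ 0)) refl s (+ p))
  rise-linear s (suc m) with rise-linear s m
  ... | p²∣⇒≡ₚ² (divides K A-[E+tD]≡Kp²) = p²∣⇒≡ₚ² (divides (K ℤ.* ((t ℤ.+ + 1) ℤ.+ + m) ℤ.+ s ℤ.* s ℤ.* D) (begin
    A ℤ.* ((t ℤ.+ + 1) ℤ.+ + m) ℤ.- (E ℤ.* (+ 1 ℤ.+ + m) ℤ.+ t ℤ.* (D ℤ.* (+ 1 ℤ.+ + m) ℤ.+ E))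
      ≡⟨ cong (λ a → a ℤ.* ((t ℤ.+ + 1) ℤ.+ + m) ℤ.- (E ℤ.* (+ 1 ℤ.+ + m) ℤ.+ t ℤ.* (D ℤ.* (+ 1 ℤ.+ + m) ℤ.+ E))) A≡Kp²+[E+tD] ⟩
    (K ℤ.* + (p ^ 2) ℤ.+ (E ℤ.+ t ℤ.* D)) ℤ.* ((t ℤ.+ + 1) ℤ.+ + m) ℤ.- (E ℤ.* (+ 1 ℤ.+ + m) ℤ.+ t ℤ.* (D ℤ.* (+ 1 ℤ.+ + m) ℤ.+ E))
      ≡⟨ cong (λ q → (K ℤ.* q ℤ.+ (E ℤ.+ t ℤ.* D)) ℤ.* ((t ℤ.+ + 1) ℤ.+ + m) ℤ.- (E ℤ.* (+ 1 ℤ.+ + m) ℤ.+ t ℤ.* (D ℤ.* (+ 1 ℤ.+ + m) ℤ.+ E))) +p²≡+p*+p ⟩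
    (K ℤ.* (+ p ℤ.* + p) ℤ.+ (E ℤ.+ t ℤ.* D)) ℤ.* ((t ℤ.+ + 1) ℤ.+ + m) ℤ.- (E ℤ.* (+ 1 ℤ.+ + m) ℤ.+ t ℤ.* (D ℤ.* (+ 1 ℤ.+ + m) ℤ.+ E))
      ≡⟨ solve 6 (λ K P E s D m → (K :* (P :* P) :+ (E :+ (s :* P) :* D)) :* (((s :* P) :+ con (+ 1)) :+ m)
                                   :- (E :* (con (+ 1) :+ m) :+ (s :* P) :* (D :* (con (+ 1) :+ m) :+ E))
                                  := (K :* (((s :* P) :+ con (+ 1)) :+ m) :+ s :* s :* D) :* (P :* P)) refl K (+ p) E s D (+ m) ⟩
    (K ℤ.* ((t ℤ.+ + 1) ℤ.+ + m) ℤ.+ s ℤ.* s ℤ.* D) ℤ.* (+ p ℤ.* + p)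
      ≡⟨ cong ((K ℤ.* ((t ℤ.+ + 1) ℤ.+ + m) ℤ.+ s ℤ.* s ℤ.* D) ℤ.*_) (sym +p²≡+p*+p) ⟩
    (K ℤ.* ((t ℤ.+ + 1) ℤ.+ + m) ℤ.+ s ℤ.* s ℤ.* D) ℤ.* + (p ^ 2) ∎))
    where
    t = s ℤ.* + p
    A = rise (t ℤ.+ + 1) m
    E = rise (+ 1) m
    D = rise-slope m
    A≡Kp²+[E+tD] : A ≡ K ℤ.* + (p ^ 2) ℤ.+ (E ℤ.+ t ℤ.* D)
    A≡Kp²+[E+tD] = trans (solve 2 (λ A B → A := (A :- B) :+ B) refl A (E ℤ.+ t ℤ.* D)) (cong (ℤ._+ (E ℤ.+ t ℤ.* D)) A-[E+tD]≡Kp²)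

module Wilson (p : ℕ) (p-prime : Prime p) (p≢2 : p ≢ 2) where
  open PAdic p p-prime
  open Morita p p-prime
  open ℤSolver.+-*-Solver

  1+[p-1]≡p : suc (p ∸ 1) ≡ p
  1+[p-1]≡p = ℕP.m+[n∸m]≡n (ℕP.<⇒≤ 1<p)

  p-1<p : p ∸ 1 < p
  p-1<p = subst (p ∸ 1 <_) 1+[p-1]≡p ℕP.≤-refl

  sign≡1⊎2∣suc : ∀ n → sign n ≡ + 1 ⊎ 2 ℕD.∣ suc n
  sign≡1⊎2∣suc zero          = inj₁ refl
  sign≡1⊎2∣suc (suc zero)    = inj₂ (ℕD.divides 1 refl)
  sign≡1⊎2∣suc (suc (suc n)) with sign≡1⊎2∣suc n
  ... | inj₁ s≡1 = inj₁ s≡1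
  ... | inj₂ (ℕD.divides q 1+n≡q*2) = inj₂ (ℕD.divides (suc q) (cong (λ m → suc (suc m)) 1+n≡q*2))

  sign[p-1]≡1 : sign (p ∸ 1) ≡ + 1
  sign[p-1]≡1 with sign≡1⊎2∣suc (p ∸ 1)
  ... | inj₁ s≡1 = s≡1
  ... | inj₂ 2∣p = ⊥-elim (Prime.notComposite p-prime (composite 2<p (subst (2 ℕD.∣_) 1+[p-1]≡p 2∣p)))
    where
    2<p : 2 < p
    2<p with ℕP.m≤n⇒m<n∨m≡n 1<p
    ... | inj₁ 2<p = 2<p
    ... | inj₂ 2≡p = ⊥-elim (p≢2 (sym 2≡p))

  [p-1]! : ℤ
  [p-1]! = rise (+ 1) (p ∸ 1)

  -- rise (1 - p) (p - 1) = ∏ (j - p) = (-1)^(p-1) (p - 1)! = (p - 1)! for odd p, while rise-linear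
  -- at s = -1 gives (p - 1)! - p · rise-slope (p - 1) modulo p².
  p∣rise-slope : + p ∣ rise-slope (p ∸ 1)
  p∣rise-slope = subst (+ p ∣_) (ℤP.neg-involutive D) (ℤD.∣m⇒∣-m (ℤD.*-cancelʳ-∣ (+ p) p*p∣-D*p))
    where
    open ≡-Reasoning
    D = rise-slope (p ∸ 1)
    -p+1≡-[p-1] : -[1+ 0 ] ℤ.* + p ℤ.+ + 1 ≡ ℤ.- + (p ∸ 1)
    -p+1≡-[p-1] = begin
      -[1+ 0 ] ℤ.* + p ℤ.+ + 1                    ≡⟨ cong (λ n → -[1+ 0 ] ℤ.* + n ℤ.+ + 1) (sym 1+[p-1]≡p) ⟩
      -[1+ 0 ] ℤ.* + suc (p ∸ 1) ℤ.+ + 1          ≡⟨ cong (λ n → -[1+ 0 ] ℤ.* n ℤ.+ + 1) (ℤP.pos-+ 1 (p ∸ 1)) ⟩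
      -[1+ 0 ] ℤ.* (+ 1 ℤ.+ + (p ∸ 1)) ℤ.+ + 1    ≡⟨ solve 1 (λ q → con -[1+ 0 ] :* (con (+ 1) :+ q) :+ con (+ 1) := :- q) refl (+ (p ∸ 1)) ⟩
      ℤ.- + (p ∸ 1)                               ∎
    rise[-p+1]≡[p-1]! : rise (-[1+ 0 ] ℤ.* + p ℤ.+ + 1) (p ∸ 1) ≡ [p-1]!
    rise[-p+1]≡[p-1]! = begin
      rise (-[1+ 0 ] ℤ.* + p ℤ.+ + 1) (p ∸ 1)    ≡⟨ cong (λ t → rise t (p ∸ 1)) -p+1≡-[p-1] ⟩
      rise (ℤ.- + (p ∸ 1)) (p ∸ 1)               ≡⟨ rise-neg (p ∸ 1) ⟩
      sign (p ∸ 1) ℤ.* [p-1]!                    ≡⟨ cong (ℤ._* [p-1]!) sign[p-1]≡1 ⟩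
      + 1 ℤ.* [p-1]!                             ≡⟨ ℤP.*-identityˡ [p-1]! ⟩
      [p-1]!                                     ∎
    [p-1]!-pD≡ₚ²[p-1]! : [p-1]! ℤ.+ -[1+ 0 ] ℤ.* + p ℤ.* D ≡ₚ² [p-1]!
    [p-1]!-pD≡ₚ²[p-1]! = ≡ₚ²-trans (≡ₚ²-sym (rise-linear -[1+ 0 ] (p ∸ 1))) (≡ₚ²-reflexive rise[-p+1]≡[p-1]!)
    p*p∣-D*p : + p ℤ.* + p ∣ (ℤ.- D) ℤ.* + p
    p*p∣-D*p = subst₂ _∣_ +p²≡+p*+p
      (solve 3 (λ E P D → (E :+ con -[1+ 0 ] :* P :* D) :- E := (:- D) :* P) refl [p-1]! (+ p) D)
      (≡ₚ²⇒p²∣ [p-1]!-pD≡ₚ²[p-1]!)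

  rise-multiple≡ₚ² : ∀ s → rise (s ℤ.* + p ℤ.+ + 1) (p ∸ 1) ≡ₚ² [p-1]!
  rise-multiple≡ₚ² s = ≡ₚ²-trans (rise-linear s (p ∸ 1)) (p²∣⇒≡ₚ² (p²∣linear-term p∣rise-slope))
    where
    open ≡-Reasoning
    E = [p-1]!
    D = rise-slope (p ∸ 1)
    p²∣linear-term : + p ∣ D → + (p ^ 2) ∣ (E ℤ.+ s ℤ.* + p ℤ.* D) ℤ.- E
    p²∣linear-term (divides q D≡q*p) = divides (s ℤ.* q) (begin
      (E ℤ.+ s ℤ.* + p ℤ.* D) ℤ.- E               ≡⟨ cong (λ d → (E ℤ.+ s ℤ.* + p ℤ.* d) ℤ.- E) D≡q*p ⟩
      (E ℤ.+ s ℤ.* + p ℤ.* (q ℤ.* + p)) ℤ.- E     ≡⟨ solve 4 (λ E s P q → (E :+ s :* P :* (q :* P)) :- E := (s :* q) :* (P :* P)) refl E s (+ p) q ⟩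
      (s ℤ.* q) ℤ.* (+ p ℤ.* + p)                 ≡⟨ cong ((s ℤ.* q) ℤ.*_) (sym +p²≡+p*+p) ⟩
      (s ℤ.* q) ℤ.* + (p ^ 2)                     ∎)

  prodCoprime-multiple : ∀ X → prodCoprime p (p ℕ.* X) ≡ₚ² [p-1]! ℤ.^ X
  prodCoprime-multiple zero    = ≡ₚ²-reflexive (cong (prodCoprime p) (ℕP.*-zeroʳ p))
  prodCoprime-multiple (suc X) = ≡ₚ²-trans (≡ₚ²-reflexive next-block)
    (≡ₚ²-trans (≡ₚ²-* (prodCoprime-multiple X) (rise-multiple≡ₚ² (+ X))) (≡ₚ²-reflexive (ℤP.*-comm ([p-1]! ℤ.^ X) [p-1]!)))
    where
    open ≡-Reasoning
    pX = p ℕ.* X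
    p[1+X]≡1+pX+[p-1] : p ℕ.* suc X ≡ suc pX ℕ.+ (p ∸ 1)
    p[1+X]≡1+pX+[p-1] = begin
      p ℕ.* suc X           ≡⟨ ℕP.*-suc p X ⟩
      p ℕ.+ pX              ≡⟨ cong (ℕ._+ pX) (sym 1+[p-1]≡p) ⟩
      suc (p ∸ 1) ℕ.+ pX    ≡⟨ cong suc (ℕP.+-comm (p ∸ 1) pX) ⟩
      suc pX ℕ.+ (p ∸ 1)    ∎
    +[1+pX]≡Xp+1 : + suc pX ≡ + X ℤ.* + p ℤ.+ + 1
    +[1+pX]≡Xp+1 = begin
      + suc pX                  ≡⟨ ℤP.pos-+ 1 pX ⟩
      + 1 ℤ.+ + pX              ≡⟨ cong (λ n → + 1 ℤ.+ n) (ℤP.pos-* p X) ⟩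
      + 1 ℤ.+ + p ℤ.* + X       ≡⟨ solve 2 (λ P X → con (+ 1) :+ P :* X := X :* P :+ con (+ 1)) refl (+ p) (+ X) ⟩
      + X ℤ.* + p ℤ.+ + 1       ∎
    run : UnitRun (suc pX) (p ∸ 1)
    run = UnitRun-below-multiple (suc pX) (p ∸ 1) (subst (p ℕD.∣_) p[1+X]≡1+pX+[p-1] (ℕD.m∣m*n (suc X))) p-1<p
    next-block : prodCoprime p (p ℕ.* suc X) ≡ prodCoprime p pX ℤ.* rise (+ X ℤ.* + p ℤ.+ + 1) (p ∸ 1)
    next-block = begin
      prodCoprime p (p ℕ.* suc X)                              ≡⟨ cong (prodCoprime p) p[1+X]≡1+pX+[p-1] ⟩
      prodCoprime p (suc pX ℕ.+ (p ∸ 1))                       ≡⟨ prodCoprime-+ (suc pX) (p ∸ 1) run ⟩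
      prodCoprime p (suc pX) ℤ.* rise (+ suc pX) (p ∸ 1)       ≡⟨ cong₂ (λ c t → c ℤ.* rise t (p ∸ 1)) (prodCoprime-suc-multiple pX (ℕD.m∣m*n X)) +[1+pX]≡Xp+1 ⟩
      prodCoprime p pX ℤ.* rise (+ X ℤ.* + p ℤ.+ + 1) (p ∸ 1)  ∎

  record ToNextMultiple (g r : ℕ) : Set where
    field
      quotient : ℕ
      reaches  : g ℕ.+ r ≡ p ℕ.* quotient
      unitRun  : UnitRun g r
  open ToNextMultiple

  toNextMultiple : ∀ {g r} → p ℕD.∣ g ℕ.+ r → r < p → ToNextMultiple g r
  toNextMultiple {g} {r} (ℕD.divides q g+r≡q*p) r<p = record
    { quotient = q
    ; reaches  = trans g+r≡q*p (ℕP.*-comm q p)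
    ; unitRun  = UnitRun-below-multiple g r (ℕD.divides q g+r≡q*p) r<p
    }

  prodCoprime*rise≡ₚ²[p-1]!^ : ∀ {g r} (n : ToNextMultiple g r) → prodCoprime p g ℤ.* rise (+ g) r ≡ₚ² [p-1]! ℤ.^ quotient n
  prodCoprime*rise≡ₚ²[p-1]!^ {g} {r} n = ≡ₚ²-trans
    (≡ₚ²-reflexive (trans (sym (prodCoprime-+ g r (unitRun n))) (cong (prodCoprime p) (reaches n))))
    (prodCoprime-multiple (quotient n))

  poch-multiple≈ : ∀ f → + p ∣ f → poch (fromℤ f) p ≈ fromℤ f ℚ.* fromℤ [p-1]!
  poch-multiple≈ f (divides s f≡s*p) = subst₂ _≈_ (sym (poch-fromℤ f p)) (fromℤ-* f [p-1]!) (≡ₚ²⇒≈ (≡ₚ²-trans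
    (≡ₚ²-reflexive (trans (cong (rise f) (sym 1+[p-1]≡p)) (rise-suc f (p ∸ 1))))
    (≡ₚ²-* (≡ₚ²-reflexive {f} refl) (subst (λ t → rise (t ℤ.+ + 1) (p ∸ 1) ≡ₚ² [p-1]!) (sym f≡s*p) (rise-multiple≡ₚ² s)))))

  Γ-quotient≈ : ∀ {g₁ g₂ g₃ g₄ r₁ r₂ r₃ r₄} δ (n₁ : ToNextMultiple g₁ r₁) (n₂ : ToNextMultiple g₂ r₂)
                (n₃ : ToNextMultiple g₃ r₃) (n₄ : ToNextMultiple g₄ r₄) →
                g₁ ℕ.+ g₂ ≡ g₃ ℕ.+ g₄ → quotient n₁ ℕ.+ quotient n₂ ≡ quotient n₃ ℕ.+ quotient n₄ ℕ.+ δ →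
                fromℤ (Γₚℕ p g₁ ℤ.* Γₚℕ p g₂) ÷' fromℤ (Γₚℕ p g₃ ℤ.* Γₚℕ p g₄)
                  ≈ fromℤ ([p-1]! ℤ.^ δ ℤ.* (rise (+ g₃) r₃ ℤ.* rise (+ g₄) r₄)) ÷' fromℤ (rise (+ g₁) r₁ ℤ.* rise (+ g₂) r₂)
  Γ-quotient≈ {g₁} {g₂} {g₃} {g₄} {r₁} {r₂} {r₃} {r₄} δ n₁ n₂ n₃ n₄ g₁+g₂≡g₃+g₄ X₁+X₂≡X₃+X₄+δ =
    fromℤ-÷'-≈ {a = Γₚℕ p g₁ ℤ.* Γₚℕ p g₂} {c = E ℤ.^ δ ℤ.* (ρ₃ ℤ.* ρ₄)}
      p∤Γ₃Γ₄ (p∤-* (p∤rise g₁ r₁ (unitRun n₁)) (p∤rise g₂ r₂ (unitRun n₂))) cross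
    where
    σ = sign g₃ ℤ.* sign g₄
    E = [p-1]!
    c : ℕ → ℤ
    c = prodCoprime p
    ρ₁ = rise (+ g₁) r₁
    ρ₂ = rise (+ g₂) r₂
    ρ₃ = rise (+ g₃) r₃
    ρ₄ = rise (+ g₄) r₄

    Γ*Γ≡sign*c*c : ∀ a b → Γₚℕ p a ℤ.* Γₚℕ p b ≡ (sign a ℤ.* sign b) ℤ.* (c a ℤ.* c b)
    Γ*Γ≡sign*c*c a b = trans (cong₂ ℤ._*_ (Γₚℕ≡sign*prodCoprime p a) (Γₚℕ≡sign*prodCoprime p b))
      (solve 4 (λ s t u v → (s :* u) :* (t :* v) := (s :* t) :* (u :* v)) refl (sign a) (sign b) (c a) (c b))

    σ₁₂≡σ : sign g₁ ℤ.* sign g₂ ≡ σ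
    σ₁₂≡σ = trans (sym (sign-+ g₁ g₂)) (trans (cong sign g₁+g₂≡g₃+g₄) (sign-+ g₃ g₄))

    p∤Γ₃Γ₄ : p∤ (Γₚℕ p g₃ ℤ.* Γₚℕ p g₄)
    p∤Γ₃Γ₄ = subst p∤_ (sym (Γ*Γ≡sign*c*c g₃ g₄)) (p∤-* (p∤-* (p∤sign g₃) (p∤sign g₄)) (p∤-* (p∤prodCoprime g₃) (p∤prodCoprime g₄)))

    E^X₁*E^X₂ : E ℤ.^ quotient n₁ ℤ.* E ℤ.^ quotient n₂ ≡ (E ℤ.^ quotient n₃ ℤ.* E ℤ.^ quotient n₄) ℤ.* E ℤ.^ δ
    E^X₁*E^X₂ = begin
      E ℤ.^ quotient n₁ ℤ.* E ℤ.^ quotient n₂                  ≡⟨ sym (ℤP.^-distribˡ-+-* E (quotient n₁) (quotient n₂)) ⟩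
      E ℤ.^ (quotient n₁ ℕ.+ quotient n₂)                      ≡⟨ cong (E ℤ.^_) X₁+X₂≡X₃+X₄+δ ⟩
      E ℤ.^ (quotient n₃ ℕ.+ quotient n₄ ℕ.+ δ)                ≡⟨ ℤP.^-distribˡ-+-* E (quotient n₃ ℕ.+ quotient n₄) δ ⟩
      E ℤ.^ (quotient n₃ ℕ.+ quotient n₄) ℤ.* E ℤ.^ δ          ≡⟨ cong (ℤ._* E ℤ.^ δ) (ℤP.^-distribˡ-+-* E (quotient n₃) (quotient n₄)) ⟩
      (E ℤ.^ quotient n₃ ℤ.* E ℤ.^ quotient n₄) ℤ.* E ℤ.^ δ   ∎
      where open ≡-Reasoning

    cross : (Γₚℕ p g₁ ℤ.* Γₚℕ p g₂) ℤ.* (ρ₁ ℤ.* ρ₂) ≡ₚ² (E ℤ.^ δ ℤ.* (ρ₃ ℤ.* ρ₄)) ℤ.* (Γₚℕ p g₃ ℤ.* Γₚℕ p g₄)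
    cross = begin
      (Γₚℕ p g₁ ℤ.* Γₚℕ p g₂) ℤ.* (ρ₁ ℤ.* ρ₂)
        ≡⟨ cong (ℤ._* (ρ₁ ℤ.* ρ₂)) (trans (Γ*Γ≡sign*c*c g₁ g₂) (cong (ℤ._* (c g₁ ℤ.* c g₂)) σ₁₂≡σ)) ⟩
      (σ ℤ.* (c g₁ ℤ.* c g₂)) ℤ.* (ρ₁ ℤ.* ρ₂)
        ≡⟨ solve 5 (λ s a b x y → (s :* (a :* b)) :* (x :* y) := s :* ((a :* x) :* (b :* y))) refl σ (c g₁) (c g₂) ρ₁ ρ₂ ⟩
      σ ℤ.* ((c g₁ ℤ.* ρ₁) ℤ.* (c g₂ ℤ.* ρ₂))
        ≈⟨ ≡ₚ²-* (≡ₚ²-reflexive {σ} refl) (≡ₚ²-* (prodCoprime*rise≡ₚ²[p-1]!^ n₁) (prodCoprime*rise≡ₚ²[p-1]!^ n₂)) ⟩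
      σ ℤ.* (E ℤ.^ quotient n₁ ℤ.* E ℤ.^ quotient n₂)
        ≡⟨ cong (σ ℤ.*_) E^X₁*E^X₂ ⟩
      σ ℤ.* ((E ℤ.^ quotient n₃ ℤ.* E ℤ.^ quotient n₄) ℤ.* E ℤ.^ δ)
        ≈⟨ ≡ₚ²-* (≡ₚ²-reflexive {σ} refl) (≡ₚ²-* (≡ₚ²-sym (≡ₚ²-* (prodCoprime*rise≡ₚ²[p-1]!^ n₃) (prodCoprime*rise≡ₚ²[p-1]!^ n₄))) (≡ₚ²-reflexive {E ℤ.^ δ} refl)) ⟩
      σ ℤ.* (((c g₃ ℤ.* ρ₃) ℤ.* (c g₄ ℤ.* ρ₄)) ℤ.* E ℤ.^ δ)
        ≡⟨ solve 6 (λ s a b x y e → s :* (((a :* x) :* (b :* y)) :* e) := (e :* (x :* y)) :* (s :* (a :* b))) refl σ (c g₃) (c g₄) ρ₃ ρ₄ (E ℤ.^ δ) ⟩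
      (E ℤ.^ δ ℤ.* (ρ₃ ℤ.* ρ₄)) ℤ.* (σ ℤ.* (c g₃ ℤ.* c g₄))
        ≡⟨ cong ((E ℤ.^ δ ℤ.* (ρ₃ ℤ.* ρ₄)) ℤ.*_) (sym (Γ*Γ≡sign*c*c g₃ g₄)) ⟩
      (E ℤ.^ δ ℤ.* (ρ₃ ℤ.* ρ₄)) ℤ.* (Γₚℕ p g₃ ℤ.* Γₚℕ p g₄) ∎
      where open SetoidReasoning ≡ₚ²-setoid

module Digits {p : ℕ} (α : ℤₚ p) where
  open ℕSolver.+-*-Solver
  open ≡-Reasoning

  negRes-spec : (digit α 0 ≡ 0 × negRes α ≡ 0) ⊎ (0 < digit α 0 × digit α 0 ℕ.+ negRes α ≡ p)
  negRes-spec with digit α 0 | digit<p α 0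
  ... | zero  | _       = inj₁ (refl , refl)
  ... | suc d | 1+d<p   = inj₂ (s≤s z≤n , ℕP.m+[n∸m]≡n (ℕP.<⇒≤ 1+d<p))

  negRes<p : 0 < p → negRes α < p
  negRes<p 0<p with negRes-spec
  ... | inj₁ (_ , n≡0)      = subst (_< p) (sym n≡0) 0<p
  ... | inj₂ (0<d , d+n≡p)  = subst (negRes α <_) d+n≡p (ℕP.m<n+m (negRes α) 0<d)

  trunc<p^ : ∀ n → trunc α n < p ^ n
  trunc<p^ zero    = s≤s z≤n
  trunc<p^ (suc n) = ℕP.<-≤-trans (ℕP.+-monoˡ-< (digit α n ℕ.* p ^ n) (trunc<p^ n)) (ℕP.*-monoˡ-≤ (p ^ n) (digit<p α n))

  trunc≡digit₀+Q*p : ∀ n → Σ ℕ λ Q → trunc α (suc n) ≡ digit α 0 ℕ.+ Q ℕ.* p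
  trunc≡digit₀+Q*p zero    = 0 , solve 1 (λ d → con 0 :+ d :* con 1 := d :+ con 0) refl (digit α 0)
  trunc≡digit₀+Q*p (suc n) with trunc≡digit₀+Q*p n
  ... | Q , eq = Q ℕ.+ digit α (suc n) ℕ.* p ^ n , (begin
    trunc α (suc n) ℕ.+ digit α (suc n) ℕ.* (p ℕ.* p ^ n)          ≡⟨ cong (ℕ._+ digit α (suc n) ℕ.* (p ℕ.* p ^ n)) eq ⟩
    digit α 0 ℕ.+ Q ℕ.* p ℕ.+ digit α (suc n) ℕ.* (p ℕ.* p ^ n)    ≡⟨ solve 5 (λ d₀ Q p d x → d₀ :+ Q :* p :+ d :* (p :* x) := d₀ :+ (Q :+ d :* x) :* p) refl (digit α 0) Q p (digit α (suc n)) (p ^ n) ⟩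
    digit α 0 ℕ.+ (Q ℕ.+ digit α (suc n) ℕ.* p ^ n) ℕ.* p          ∎)

  p∣digit₀+negRes : p ℕD.∣ digit α 0 ℕ.+ negRes α
  p∣digit₀+negRes with negRes-spec
  ... | inj₁ (d≡0 , n≡0)  = subst (p ℕD.∣_) (sym (cong₂ ℕ._+_ d≡0 n≡0)) (p ℕD.∣0)
  ... | inj₂ (_ , d+n≡p)  = subst (p ℕD.∣_) (sym d+n≡p) ℕD.∣-refl

  p∣trunc+negRes : ∀ n → p ℕD.∣ trunc α (suc n) ℕ.+ negRes α
  p∣trunc+negRes n with trunc≡digit₀+Q*p n
  ... | Q , eq = subst (p ℕD.∣_) d₀+n+Qp≡trunc+n (ℕD.∣m∣n⇒∣m+n p∣digit₀+negRes (ℕD.n∣m*n Q))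
    where
    d₀+n+Qp≡trunc+n : digit α 0 ℕ.+ negRes α ℕ.+ Q ℕ.* p ≡ trunc α (suc n) ℕ.+ negRes α
    d₀+n+Qp≡trunc+n = begin
      digit α 0 ℕ.+ negRes α ℕ.+ Q ℕ.* p   ≡⟨ solve 3 (λ d n q → d :+ n :+ q := d :+ q :+ n) refl (digit α 0) (negRes α) (Q ℕ.* p) ⟩
      digit α 0 ℕ.+ Q ℕ.* p ℕ.+ negRes α   ≡⟨ cong (ℕ._+ negRes α) (sym eq) ⟩
      trunc α (suc n) ℕ.+ negRes α         ∎

module GammaArguments (A B C P : ℕ) (A<P : A < P) (B<P : B < P) where
  open ℕSolver.+-*-Solver

  -- Representatives of γ, γ - α - β, γ - α, γ - β, as in GammaQuot.
  g₁ g₂ g₃ g₄ : ℕ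
  g₁ = C
  g₂ = (C ℕ.+ 2 ℕ.* P) ∸ (A ℕ.+ B)
  g₃ = (C ℕ.+ P) ∸ A
  g₄ = (C ℕ.+ P) ∸ B

  g₃+A≡C+P : g₃ ℕ.+ A ≡ C ℕ.+ P
  g₃+A≡C+P = ℕP.m∸n+n≡m (ℕP.≤-trans (ℕP.<⇒≤ A<P) (ℕP.m≤n+m P C))

  g₄+B≡C+P : g₄ ℕ.+ B ≡ C ℕ.+ P
  g₄+B≡C+P = ℕP.m∸n+n≡m (ℕP.≤-trans (ℕP.<⇒≤ B<P) (ℕP.m≤n+m P C))

  g₂+[A+B]≡C+2P : g₂ ℕ.+ (A ℕ.+ B) ≡ C ℕ.+ 2 ℕ.* P
  g₂+[A+B]≡C+2P = ℕP.m∸n+n≡m (ℕP.≤-trans (ℕP.+-mono-≤ (ℕP.<⇒≤ A<P) (ℕP.≤-trans (ℕP.<⇒≤ B<P) (ℕP.m≤m+n P 0))) (ℕP.m≤n+m (2 ℕ.* P) C))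

  g₁+g₂≡g₃+g₄ : g₁ ℕ.+ g₂ ≡ g₃ ℕ.+ g₄
  g₁+g₂≡g₃+g₄ = ℕP.+-cancelʳ-≡ (A ℕ.+ B) (g₁ ℕ.+ g₂) (g₃ ℕ.+ g₄) (begin
    (C ℕ.+ g₂) ℕ.+ (A ℕ.+ B)           ≡⟨ ℕP.+-assoc C g₂ (A ℕ.+ B) ⟩
    C ℕ.+ (g₂ ℕ.+ (A ℕ.+ B))           ≡⟨ cong (C ℕ.+_) g₂+[A+B]≡C+2P ⟩
    C ℕ.+ (C ℕ.+ 2 ℕ.* P)              ≡⟨ solve 2 (λ C P → C :+ (C :+ con 2 :* P) := (C :+ P) :+ (C :+ P)) refl C P ⟩
    (C ℕ.+ P) ℕ.+ (C ℕ.+ P)            ≡⟨ sym (cong₂ ℕ._+_ g₃+A≡C+P g₄+B≡C+P) ⟩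
    (g₃ ℕ.+ A) ℕ.+ (g₄ ℕ.+ B)          ≡⟨ solve 4 (λ a b c d → (a :+ b) :+ (c :+ d) := (a :+ c) :+ (b :+ d)) refl g₃ A g₄ B ⟩
    (g₃ ℕ.+ g₄) ℕ.+ (A ℕ.+ B)          ∎)
    where open ≡-Reasoning


  shifted-sum : ∀ g X r x c → g ℕ.+ X ≡ C ℕ.+ P → r ℕ.+ x ≡ c → g ℕ.+ r ℕ.+ (X ℕ.+ x) ≡ (C ℕ.+ c) ℕ.+ P
  shifted-sum g X r x c g+X≡C+P r+x≡c = begin
    g ℕ.+ r ℕ.+ (X ℕ.+ x)       ≡⟨ solve 4 (λ g r X x → g :+ r :+ (X :+ x) := (g :+ X) :+ (r :+ x)) refl g r X x ⟩
    (g ℕ.+ X) ℕ.+ (r ℕ.+ x)     ≡⟨ cong₂ ℕ._+_ g+X≡C+P r+x≡c ⟩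
    (C ℕ.+ P) ℕ.+ c             ≡⟨ solve 3 (λ C P c → (C :+ P) :+ c := (C :+ c) :+ P) refl C P c ⟩
    (C ℕ.+ c) ℕ.+ P             ∎
    where open ≡-Reasoning

  g₂-sum : ∀ a b c r₂ d → r₂ ℕ.+ (a ℕ.+ b) ≡ c ℕ.+ d →
           (g₂ ℕ.+ r₂) ℕ.+ ((A ℕ.+ a) ℕ.+ (B ℕ.+ b)) ≡ (C ℕ.+ c) ℕ.+ (2 ℕ.* P ℕ.+ d)
  g₂-sum a b c r₂ d r₂+[a+b]≡c+d = begin
    (g₂ ℕ.+ r₂) ℕ.+ ((A ℕ.+ a) ℕ.+ (B ℕ.+ b))   ≡⟨ solve 6 (λ g r A a B b → (g :+ r) :+ ((A :+ a) :+ (B :+ b)) := (g :+ (A :+ B)) :+ (r :+ (a :+ b))) refl g₂ r₂ A a B b ⟩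
    (g₂ ℕ.+ (A ℕ.+ B)) ℕ.+ (r₂ ℕ.+ (a ℕ.+ b))   ≡⟨ cong₂ ℕ._+_ g₂+[A+B]≡C+2P r₂+[a+b]≡c+d ⟩
    (C ℕ.+ 2 ℕ.* P) ℕ.+ (c ℕ.+ d)               ≡⟨ solve 4 (λ C P c d → (C :+ con 2 :* P) :+ (c :+ d) := (C :+ c) :+ (con 2 :* P :+ d)) refl C P c d ⟩
    (C ℕ.+ c) ℕ.+ (2 ℕ.* P ℕ.+ d)               ∎
    where open ≡-Reasoning

  block-sum : ∀ a b c r₂ d → a ≤ c → b ≤ c → r₂ ℕ.+ (a ℕ.+ b) ≡ c ℕ.+ d →
              (g₁ ℕ.+ c) ℕ.+ (g₂ ℕ.+ r₂) ≡ ((g₃ ℕ.+ (c ∸ a)) ℕ.+ (g₄ ℕ.+ (c ∸ b))) ℕ.+ d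
  block-sum a b c r₂ d a≤c b≤c r₂+[a+b]≡c+d = ℕP.+-cancelʳ-≡ S _ _ (begin
    ((C ℕ.+ c) ℕ.+ (g₂ ℕ.+ r₂)) ℕ.+ S                       ≡⟨ ℕP.+-assoc (C ℕ.+ c) (g₂ ℕ.+ r₂) S ⟩
    (C ℕ.+ c) ℕ.+ ((g₂ ℕ.+ r₂) ℕ.+ S)                       ≡⟨ cong ((C ℕ.+ c) ℕ.+_) (g₂-sum a b c r₂ d r₂+[a+b]≡c+d) ⟩
    (C ℕ.+ c) ℕ.+ ((C ℕ.+ c) ℕ.+ (2 ℕ.* P ℕ.+ d))           ≡⟨ solve 3 (λ K P d → K :+ (K :+ (con 2 :* P :+ d)) := ((K :+ P) :+ (K :+ P)) :+ d) refl (C ℕ.+ c) P d ⟩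
    ((C ℕ.+ c ℕ.+ P) ℕ.+ (C ℕ.+ c ℕ.+ P)) ℕ.+ d             ≡⟨ cong (ℕ._+ d) (sym (cong₂ ℕ._+_ (shifted-sum g₃ A (c ∸ a) a c g₃+A≡C+P (ℕP.m∸n+n≡m a≤c)) (shifted-sum g₄ B (c ∸ b) b c g₄+B≡C+P (ℕP.m∸n+n≡m b≤c)))) ⟩
    ((g₃ ℕ.+ (c ∸ a) ℕ.+ (A ℕ.+ a)) ℕ.+ (g₄ ℕ.+ (c ∸ b) ℕ.+ (B ℕ.+ b))) ℕ.+ d
      ≡⟨ solve 5 (λ x y u v d → ((x :+ u) :+ (y :+ v)) :+ d := ((x :+ y) :+ d) :+ (u :+ v)) refl (g₃ ℕ.+ (c ∸ a)) (g₄ ℕ.+ (c ∸ b)) (A ℕ.+ a) (B ℕ.+ b) d ⟩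
    (((g₃ ℕ.+ (c ∸ a)) ℕ.+ (g₄ ℕ.+ (c ∸ b))) ℕ.+ d) ℕ.+ S   ∎)
    where
    open ≡-Reasoning
    S = (A ℕ.+ a) ℕ.+ (B ℕ.+ b)


a+[c∸[a+b]]≡c∸b : ∀ a b c → a ℕ.+ b ≤ c → a ℕ.+ (c ∸ (a ℕ.+ b)) ≡ c ∸ b
a+[c∸[a+b]]≡c∸b a b c a+b≤c = trans (sym (ℕP.+-∸-assoc a a+b≤c)) (ℕP.[m+n]∸[m+o]≡n∸o a c b)

[c∸b]+[[a+b]∸c]≡a : ∀ a b c → b ≤ c → c ≤ a ℕ.+ b → (c ∸ b) ℕ.+ ((a ℕ.+ b) ∸ c) ≡ a
[c∸b]+[[a+b]∸c]≡a a b c b≤c c≤a+b = begin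
  (c ∸ b) ℕ.+ ((a ℕ.+ b) ∸ c)      ≡⟨ ℕP.+-comm (c ∸ b) ((a ℕ.+ b) ∸ c) ⟩
  ((a ℕ.+ b) ∸ c) ℕ.+ (c ∸ b)      ≡⟨ sym (ℕP.+-∸-assoc ((a ℕ.+ b) ∸ c) b≤c) ⟩
  ((a ℕ.+ b) ∸ c ℕ.+ c) ∸ b        ≡⟨ cong (_∸ b) (ℕP.m∸n+n≡m c≤a+b) ⟩
  (a ℕ.+ b) ∸ b                    ≡⟨ ℕP.m+n∸n≡m a b ⟩
  a                                ∎
  where open ≡-Reasoning

-- A, B, C represent α, β, γ modulo P, and a, b, c are ⟨-α⟩ₚ, ⟨-β⟩ₚ, ⟨-γ⟩ₚ.
module AtRepresentatives (p : ℕ) (p-prime : Prime p) (p≢2 : p ≢ 2) (A B C a b c P : ℕ)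
            (p²∣P : p ^ 2 ℕD.∣ P) (A<P : A < P) (B<P : B < P)
            (p∣A+a : p ℕD.∣ A ℕ.+ a) (p∣B+b : p ℕD.∣ B ℕ.+ b) (p∣C+c : p ℕD.∣ C ℕ.+ c)
            (c<p : c < p) (a≤c : a ≤ c) (b≤c : b ≤ c) where
  open PAdic p p-prime
  open Morita p p-prime
  open Wilson p p-prime p≢2
  open import Data.Rational using (_+_; _*_; _-_; -_)
  open ℚSolver.+-*-Solver

  x₀ x₁ y₀ y₁ z : ℚ
  x₀ = - ℚℕ a
  x₁ = ℚℕ A
  y₀ = - ℚℕ b
  y₁ = ℚℕ B
  z  = ℚℕ C

  open Grid p p-prime x₀ x₁ y₀ y₁
  open GammaArguments A B C P A<P B<P

  1≤ᵥ-shift : ∀ X x → p ℕD.∣ X ℕ.+ x → 1 ≤ᵥ ℚℕ X - (- ℚℕ x)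
  1≤ᵥ-shift X x p∣X+x =
    subst (1 ≤ᵥ_) (trans (ℚℕ-+ X x) (solve 2 (λ u v → u :+ v := u :- (:- v)) refl (ℚℕ X) (ℚℕ x))) (p∣⇒1≤ᵥℚℕ p∣X+x)

  regular-x : Regular (λ x _ → x)
  regular-x = Regular-x (≤ᵥ-neg (0≤ᵥℚℕ a)) (0≤ᵥℚℕ A) (1≤ᵥ-shift A a p∣A+a)

  regular-y : Regular (λ _ y → y)
  regular-y = Regular-y (≤ᵥ-neg (0≤ᵥℚℕ b)) (0≤ᵥℚℕ B) (1≤ᵥ-shift B b p∣B+b)

  regular-z : Regular (λ _ _ → z)
  regular-z = Regular-const z (0≤ᵥℚℕ C)

  IsUnitℚ-poch-z : ∀ k → k ≤ c → IsUnitℚ (poch z k)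
  IsUnitℚ-poch-z k k≤c = subst IsUnitℚ (sym (poch-fromℤ (+ C) k))
    (IsUnitℚ-fromℤ (p∤rise C k (λ i i<k → UnitRun-below-multiple C c p∣C+c c<p i (ℕP.<-≤-trans i<k k≤c))))

  regular-F21 : Regular (λ x y → Σ≤ (F21-term x y z) c)
  regular-F21 = Regular-Σ≤ {λ k x y → F21-term x y z k} c λ k k≤c →
    Regular-* (Regular-* (Regular-poch k regular-x) (Regular-poch k regular-y))
              (Regular-const _ (≤ᵥ-÷' (0≤ᵥfromℤ (+ 1)) (IsUnitℚ-* (IsUnitℚ-poch-z k k≤c) (IsUnitℚ-fact k (ℕP.≤-<-trans k≤c c<p)))))

  F21≈closedForm : ∀ m m′ → a ℕ.+ m′ ≡ (c ∸ b) ℕ.+ m → b ℕ.+ m′ ≡ (c ∸ a) ℕ.+ m → m ≡ 0 ⊎ m′ ≡ 0 →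
                   IsUnitℚ (poch (z - x₁ - y₁) m′) →
                   Σ≤ (F21-term x₁ y₁ z) c ≈ closedForm-num z c a b m x₁ y₁ ÷' closedForm-den z c m′ x₁ y₁
  F21≈closedForm m m′ a+m′≡[c-b]+m b+m′≡[c-a]+m m≡0⊎m′≡0 last-factor-unit =
    2≤ᵥ⇒≈ (subst (2 ≤ᵥ_) G/D≡T-N/D (≤ᵥ-*ʳ (Regular-vanishing regular-G G[x₀,-]≡0 G[-,y₀]≡0) (≤ᵥ-÷' (0≤ᵥfromℤ (+ 1)) D₁₁-unit)))
    where
    open ≡-Reasoning
    T D N G : ℚ → ℚ → ℚ
    T x y = Σ≤ (F21-term x y z) c
    D = closedForm-den z c m′
    N = closedForm-num z c a b m
    G x y = T x y * D x y - N x y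

    regular-G : Regular G
    regular-G = Regular-- (Regular-* regular-F21 (Regular-* (Regular-const (poch z c) (0≤ᵥ-poch c (0≤ᵥℚℕ C)))
                                                           (Regular-poch m′ (Regular-- (Regular-- regular-z regular-x) regular-y))))
                          (Regular-* (Regular-* (Regular-poch (c ∸ a) (Regular-- regular-z regular-x)) (Regular-poch (c ∸ b) (Regular-- regular-z regular-y)))
                                     (Regular-poch m (Regular-- (Regular-- (Regular-- regular-z regular-x) regular-y) (Regular-const (ℚℕ m) (0≤ᵥℚℕ m)))))

    poch-z≢0 : ∀ k → k ≤ c → poch z k ≢ 0ℚ
    poch-z≢0 k k≤c = IsUnitℚ⇒≢0 (IsUnitℚ-poch-z k k≤c)

    G[x₀,-]≡0 : ∀ y → G x₀ y ≡ 0ℚ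
    G[x₀,-]≡0 y = trans (cong (_- N x₀ y) (F21-closedForm-at-neg a b c m m′ y z a≤c a+m′≡[c-b]+m m≡0⊎m′≡0 (λ k k≤a → poch-z≢0 k (ℕP.≤-trans k≤a a≤c))))
                        (ℚP.+-inverseʳ (N x₀ y))

    G[-,y₀]≡0 : ∀ x → G x y₀ ≡ 0ℚ
    G[-,y₀]≡0 x = trans (cong₂ _-_ TD≡N′ N≡N′) (ℚP.+-inverseʳ N′)
      where
      N′ = closedForm-num z c b a m y₀ x
      TD≡N′ : T x y₀ * D x y₀ ≡ N′
      TD≡N′ = trans (cong₂ _*_ (Σ≤-cong c (λ k _ → cong (_* (1ℚ ÷' (poch z k * fact k))) (ℚP.*-comm (poch x k) (poch y₀ k))))
                                (cong (λ t → poch z c * poch t m′) (solve 3 (λ z x y → z :- x :- y := z :- y :- x) refl z x y₀)))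
                    (F21-closedForm-at-neg b a c m m′ x z b≤c b+m′≡[c-a]+m m≡0⊎m′≡0 (λ k k≤b → poch-z≢0 k (ℕP.≤-trans k≤b b≤c)))
      N≡N′ : N x y₀ ≡ N′
      N≡N′ = begin
        poch (z - x) (c ∸ a) * poch (z - y₀) (c ∸ b) * poch (z - x - y₀ - ℚℕ m) m
          ≡⟨ cong (λ t → poch (z - x) (c ∸ a) * poch (z - y₀) (c ∸ b) * poch t m) (solve 4 (λ z x y u → z :- x :- y :- u := z :- y :- x :- u) refl z x y₀ (ℚℕ m)) ⟩
        poch (z - x) (c ∸ a) * poch (z - y₀) (c ∸ b) * poch (z - y₀ - x - ℚℕ m) m
          ≡⟨ cong (_* poch (z - y₀ - x - ℚℕ m) m) (ℚP.*-comm (poch (z - x) (c ∸ a)) (poch (z - y₀) (c ∸ b))) ⟩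
        N′ ∎

    D₁₁-unit : IsUnitℚ (D x₁ y₁)
    D₁₁-unit = IsUnitℚ-* (IsUnitℚ-poch-z c ℕP.≤-refl) last-factor-unit

    G/D≡T-N/D : G x₁ y₁ * (1ℚ ÷' D x₁ y₁) ≡ T x₁ y₁ - N x₁ y₁ ÷' D x₁ y₁
    G/D≡T-N/D = begin
      (T₁₁ * D₁₁ - N₁₁) * (1ℚ ÷' D₁₁)                ≡⟨ solve 4 (λ T D N u → (T :* D :- N) :* u := T :* (D :* u) :- N :* u) refl T₁₁ D₁₁ N₁₁ (1ℚ ÷' D₁₁) ⟩
      T₁₁ * (D₁₁ * (1ℚ ÷' D₁₁)) - N₁₁ * (1ℚ ÷' D₁₁) ≡⟨ cong₂ (λ s t → T₁₁ * s - t) (÷'-inverseʳ D₁₁ (IsUnitℚ⇒≢0 D₁₁-unit)) (sym (÷'≡*1÷' N₁₁ D₁₁)) ⟩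
      T₁₁ * 1ℚ - N₁₁ ÷' D₁₁                          ≡⟨ cong (_- N₁₁ ÷' D₁₁) (ℚP.*-identityʳ T₁₁) ⟩
      T₁₁ - N₁₁ ÷' D₁₁                               ∎
      where
      T₁₁ = T x₁ y₁
      D₁₁ = D x₁ y₁
      N₁₁ = N x₁ y₁

  GammaQuotient : ℚ
  GammaQuotient = fromℤ (Γₚℕ p g₁ ℤ.* Γₚℕ p g₂) ÷' fromℤ (Γₚℕ p g₃ ℤ.* Γₚℕ p g₄)

  ℚℕ≈z-shift : ∀ g X Q → g ℕ.+ X ≡ C ℕ.+ Q → p ^ 2 ℕD.∣ Q → ℚℕ g ≈ z - ℚℕ X
  ℚℕ≈z-shift g X Q g+X≡C+Q p²∣Q = 2≤ᵥ⇒≈ (subst (2 ≤ᵥ_) Q≡g-[z-X] (p^∣⇒≤ᵥℚℕ p²∣Q))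
    where
    open ≡-Reasoning
    Q≡g-[z-X] : ℚℕ Q ≡ ℚℕ g - (z - ℚℕ X)
    Q≡g-[z-X] = begin
      ℚℕ Q                        ≡⟨ solve 2 (λ C Q → Q := (C :+ Q) :- C) refl z (ℚℕ Q) ⟩
      (z + ℚℕ Q) - z              ≡⟨ cong (_- z) (trans (sym (ℚℕ-+ C Q)) (trans (cong ℚℕ (sym g+X≡C+Q)) (ℚℕ-+ g X))) ⟩
      (ℚℕ g + ℚℕ X) - z           ≡⟨ solve 3 (λ g x C → (g :+ x) :- C := g :- (C :- x)) refl (ℚℕ g) (ℚℕ X) z ⟩
      ℚℕ g - (z - ℚℕ X)           ∎

  g₃≈z-x₁ : ℚℕ g₃ ≈ z - x₁
  g₃≈z-x₁ = ℚℕ≈z-shift g₃ A P g₃+A≡C+P p²∣P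

  g₄≈z-y₁ : ℚℕ g₄ ≈ z - y₁
  g₄≈z-y₁ = ℚℕ≈z-shift g₄ B P g₄+B≡C+P p²∣P

  g₂≈z-x₁-y₁ : ℚℕ g₂ ≈ z - x₁ - y₁
  g₂≈z-x₁-y₁ = subst (ℚℕ g₂ ≈_) (trans (cong (λ t → z - t) (ℚℕ-+ A B)) (solve 3 (λ z a b → z :- (a :+ b) := z :- a :- b) refl z x₁ y₁))
    (ℚℕ≈z-shift g₂ (A ℕ.+ B) (2 ℕ.* P) g₂+[A+B]≡C+2P (ℕD.∣-trans p²∣P (ℕD.n∣m*n 2)))

  poch≈rise : ∀ {u} g r → ℚℕ g ≈ u → 0 ≤ᵥ u → poch u r ≈ fromℤ (rise (+ g) r)
  poch≈rise g r g≈u 0≤ᵥu = subst (_ ≈_) (poch-fromℤ (+ g) r) (≈-poch r (≈-sym g≈u) 0≤ᵥu (0≤ᵥℚℕ g))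

  0≤ᵥz-x₁ : 0 ≤ᵥ z - x₁
  0≤ᵥz-x₁ = ≤ᵥ-- (0≤ᵥℚℕ C) (0≤ᵥℚℕ A)

  0≤ᵥz-y₁ : 0 ≤ᵥ z - y₁
  0≤ᵥz-y₁ = ≤ᵥ-- (0≤ᵥℚℕ C) (0≤ᵥℚℕ B)

  0≤ᵥz-x₁-y₁ : 0 ≤ᵥ z - x₁ - y₁
  0≤ᵥz-x₁-y₁ = ≤ᵥ-- 0≤ᵥz-x₁ (0≤ᵥℚℕ B)

  open ToNextMultiple

  p∣P : p ℕD.∣ P
  p∣P = ℕD.∣-trans (ℕD.m∣m*n (p ^ 1)) p²∣P

  p∣shifted : ∀ g X r x → g ℕ.+ X ≡ C ℕ.+ P → r ℕ.+ x ≡ c → p ℕD.∣ X ℕ.+ x → p ℕD.∣ g ℕ.+ r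
  p∣shifted g X r x g+X≡C+P r+x≡c p∣X+x =
    ℕD.∣m+n∣m⇒∣n (subst (p ℕD.∣_) (ℕP.+-comm (g ℕ.+ r) (X ℕ.+ x)) (subst (p ℕD.∣_) (sym (shifted-sum g X r x c g+X≡C+P r+x≡c)) (ℕD.∣m∣n⇒∣m+n p∣C+c p∣P))) p∣X+x

  toNext₁ : ToNextMultiple g₁ c
  toNext₁ = toNextMultiple p∣C+c c<p

  toNext₃ : ToNextMultiple g₃ (c ∸ a)
  toNext₃ = toNextMultiple (p∣shifted g₃ A (c ∸ a) a g₃+A≡C+P (ℕP.m∸n+n≡m a≤c) p∣A+a) (ℕP.≤-<-trans (ℕP.m∸n≤m c a) c<p)

  toNext₄ : ToNextMultiple g₄ (c ∸ b)
  toNext₄ = toNextMultiple (p∣shifted g₄ B (c ∸ b) b g₄+B≡C+P (ℕP.m∸n+n≡m b≤c) p∣B+b) (ℕP.≤-<-trans (ℕP.m∸n≤m c b) c<p)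

  p∣g₂+r₂ : ∀ r₂ δ → r₂ ℕ.+ (a ℕ.+ b) ≡ c ℕ.+ p ℕ.* δ → p ℕD.∣ g₂ ℕ.+ r₂
  p∣g₂+r₂ r₂ δ r₂+[a+b]≡c+pδ = ℕD.∣m+n∣m⇒∣n (subst (p ℕD.∣_) (ℕP.+-comm (g₂ ℕ.+ r₂) ((A ℕ.+ a) ℕ.+ (B ℕ.+ b))) p∣sum) (ℕD.∣m∣n⇒∣m+n p∣A+a p∣B+b)
    where
    p∣sum : p ℕD.∣ (g₂ ℕ.+ r₂) ℕ.+ ((A ℕ.+ a) ℕ.+ (B ℕ.+ b))
    p∣sum = subst (p ℕD.∣_) (sym (g₂-sum a b c r₂ (p ℕ.* δ) r₂+[a+b]≡c+pδ))
      (ℕD.∣m∣n⇒∣m+n p∣C+c (ℕD.∣m∣n⇒∣m+n (ℕD.∣-trans p∣P (ℕD.n∣m*n 2)) (ℕD.m∣m*n δ)))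

  GammaQuotient≈ : ∀ r₂ δ → r₂ < p → r₂ ℕ.+ (a ℕ.+ b) ≡ c ℕ.+ p ℕ.* δ →
                   GammaQuotient ≈ fromℤ ([p-1]! ℤ.^ δ ℤ.* (rise (+ g₃) (c ∸ a) ℤ.* rise (+ g₄) (c ∸ b))) ÷' fromℤ (rise (+ g₁) c ℤ.* rise (+ g₂) r₂)
  GammaQuotient≈ r₂ δ r₂<p r₂+[a+b]≡c+pδ = Γ-quotient≈ δ toNext₁ toNext₂ toNext₃ toNext₄ g₁+g₂≡g₃+g₄ X₁+X₂≡X₃+X₄+δ
    where
    open ≡-Reasoning
    toNext₂ : ToNextMultiple g₂ r₂
    toNext₂ = toNextMultiple (p∣g₂+r₂ r₂ δ r₂+[a+b]≡c+pδ) r₂<p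
    X₁ = quotient toNext₁
    X₂ = quotient toNext₂
    X₃ = quotient toNext₃
    X₄ = quotient toNext₄
    X₁+X₂≡X₃+X₄+δ : X₁ ℕ.+ X₂ ≡ X₃ ℕ.+ X₄ ℕ.+ δ
    X₁+X₂≡X₃+X₄+δ = ℕP.*-cancelˡ-≡ (X₁ ℕ.+ X₂) (X₃ ℕ.+ X₄ ℕ.+ δ) p {{ℕ.>-nonZero (ℕP.<-trans ℕP.0<1+n 1<p)}} (begin
      p ℕ.* (X₁ ℕ.+ X₂)                                   ≡⟨ ℕP.*-distribˡ-+ p X₁ X₂ ⟩
      p ℕ.* X₁ ℕ.+ p ℕ.* X₂                               ≡⟨ sym (cong₂ ℕ._+_ (reaches toNext₁) (reaches toNext₂)) ⟩
      (g₁ ℕ.+ c) ℕ.+ (g₂ ℕ.+ r₂)                          ≡⟨ block-sum a b c r₂ (p ℕ.* δ) a≤c b≤c r₂+[a+b]≡c+pδ ⟩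
      ((g₃ ℕ.+ (c ∸ a)) ℕ.+ (g₄ ℕ.+ (c ∸ b))) ℕ.+ p ℕ.* δ ≡⟨ cong (ℕ._+ p ℕ.* δ) (cong₂ ℕ._+_ (reaches toNext₃) (reaches toNext₄)) ⟩
      (p ℕ.* X₃ ℕ.+ p ℕ.* X₄) ℕ.+ p ℕ.* δ                 ≡⟨ sym (cong (ℕ._+ p ℕ.* δ) (ℕP.*-distribˡ-+ p X₃ X₄)) ⟩
      p ℕ.* (X₃ ℕ.+ X₄) ℕ.+ p ℕ.* δ                       ≡⟨ sym (ℕP.*-distribˡ-+ p (X₃ ℕ.+ X₄) δ) ⟩
      p ℕ.* (X₃ ℕ.+ X₄ ℕ.+ δ)                             ∎)

  ρ₁ ρ₃ ρ₄ : ℤ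
  ρ₁ = rise (+ g₁) c
  ρ₃ = rise (+ g₃) (c ∸ a)
  ρ₄ = rise (+ g₄) (c ∸ b)

  ρ₂ : ℕ → ℤ
  ρ₂ r₂ = rise (+ g₂) r₂

  poch-z≡ρ₁ : poch z c ≡ fromℤ ρ₁
  poch-z≡ρ₁ = poch-fromℤ (+ C) c

  ρ₁-unit : IsUnitℚ (fromℤ ρ₁)
  ρ₁-unit = IsUnitℚ-fromℤ (p∤rise g₁ c (unitRun toNext₁))

  ρ₂-unit : ∀ r₂ δ → r₂ < p → r₂ ℕ.+ (a ℕ.+ b) ≡ c ℕ.+ p ℕ.* δ → IsUnitℚ (fromℤ (ρ₂ r₂))
  ρ₂-unit r₂ δ r₂<p r₂+[a+b]≡c+pδ = IsUnitℚ-fromℤ (p∤rise g₂ r₂ (unitRun (toNextMultiple (p∣g₂+r₂ r₂ δ r₂+[a+b]≡c+pδ) r₂<p)))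

  poch-z-x₁*poch-z-y₁≈ρ₃ρ₄ : poch (z - x₁) (c ∸ a) * poch (z - y₁) (c ∸ b) ≈ fromℤ ρ₃ * fromℤ ρ₄
  poch-z-x₁*poch-z-y₁≈ρ₃ρ₄ = ≈-* (poch≈rise g₃ (c ∸ a) g₃≈z-x₁ 0≤ᵥz-x₁) (poch≈rise g₄ (c ∸ b) g₄≈z-y₁ 0≤ᵥz-y₁)
                                 (0≤ᵥfromℤ ρ₃) (0≤ᵥ-poch (c ∸ b) 0≤ᵥz-y₁)

  module PartI (a+b≤c : a ℕ.+ b ≤ c) where
    m′ : ℕ
    m′ = c ∸ (a ℕ.+ b)

    m′<p : m′ < p
    m′<p = ℕP.≤-<-trans (ℕP.m∸n≤m c (a ℕ.+ b)) c<p

    m′+[a+b]≡c+p*0 : m′ ℕ.+ (a ℕ.+ b) ≡ c ℕ.+ p ℕ.* 0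
    m′+[a+b]≡c+p*0 = trans (ℕP.m∸n+n≡m a+b≤c) (sym (trans (cong (c ℕ.+_) (ℕP.*-zeroʳ p)) (ℕP.+-identityʳ c)))

    a+m′≡[c-b]+0 : a ℕ.+ m′ ≡ (c ∸ b) ℕ.+ 0
    a+m′≡[c-b]+0 = trans (a+[c∸[a+b]]≡c∸b a b c a+b≤c) (sym (ℕP.+-identityʳ (c ∸ b)))

    b+m′≡[c-a]+0 : b ℕ.+ m′ ≡ (c ∸ a) ℕ.+ 0
    b+m′≡[c-a]+0 = trans (cong (λ n → b ℕ.+ (c ∸ n)) (ℕP.+-comm a b))
                         (trans (a+[c∸[a+b]]≡c∸b b a c (subst (_≤ c) (ℕP.+-comm a b) a+b≤c)) (sym (ℕP.+-identityʳ (c ∸ a))))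

    ρ₂-m′-unit : IsUnitℚ (fromℤ (ρ₂ m′))
    ρ₂-m′-unit = ρ₂-unit m′ 0 m′<p m′+[a+b]≡c+p*0

    last-factor≈ρ₂ : poch (z - x₁ - y₁) m′ ≈ fromℤ (ρ₂ m′)
    last-factor≈ρ₂ = poch≈rise g₂ m′ g₂≈z-x₁-y₁ 0≤ᵥz-x₁-y₁

    last-factor-unit : IsUnitℚ (poch (z - x₁ - y₁) m′)
    last-factor-unit = IsUnitℚ-close (0≤ᵥ-poch m′ 0≤ᵥz-x₁-y₁) (≤ᵥ-weaken (s≤s z≤n) (≈⇒2≤ᵥ last-factor≈ρ₂)) ρ₂-m′-unit

    F21≈Γ : Σ≤ (F21-term x₁ y₁ z) c ≈ GammaQuotient
    F21≈Γ = begin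
      Σ≤ (F21-term x₁ y₁ z) c
        ≈⟨ F21≈closedForm 0 m′ a+m′≡[c-b]+0 b+m′≡[c-a]+0 (inj₁ refl) last-factor-unit ⟩
      closedForm-num z c a b 0 x₁ y₁ ÷' closedForm-den z c m′ x₁ y₁
        ≈⟨ ≈-÷' (≈-* poch-z-x₁*poch-z-y₁≈ρ₃ρ₄ ≈-refl (≤ᵥ-* (0≤ᵥfromℤ ρ₃) (0≤ᵥfromℤ ρ₄)) (0≤ᵥfromℤ (+ 1)))
                (≈-* (≈-reflexive poch-z≡ρ₁) last-factor≈ρ₂ (0≤ᵥfromℤ ρ₁) (0≤ᵥ-poch m′ 0≤ᵥz-x₁-y₁))
                (≤ᵥ-*ʳ (≤ᵥ-* (0≤ᵥfromℤ ρ₃) (0≤ᵥfromℤ ρ₄)) (0≤ᵥfromℤ (+ 1)))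
                (IsUnitℚ-* (IsUnitℚ-poch-z c ℕP.≤-refl) last-factor-unit) (IsUnitℚ-* ρ₁-unit ρ₂-m′-unit) ⟩
      (fromℤ ρ₃ * fromℤ ρ₄ * 1ℚ) ÷' (fromℤ ρ₁ * fromℤ (ρ₂ m′))
        ≡⟨ cong₂ _÷'_ (trans (ℚP.*-identityʳ _) (trans (sym (fromℤ-* ρ₃ ρ₄)) (cong fromℤ (sym (ℤP.*-identityˡ (ρ₃ ℤ.* ρ₄))))))
                      (sym (fromℤ-* ρ₁ (ρ₂ m′))) ⟩
      fromℤ ([p-1]! ℤ.^ 0 ℤ.* (ρ₃ ℤ.* ρ₄)) ÷' fromℤ (ρ₁ ℤ.* ρ₂ m′)
        ≈⟨ GammaQuotient≈ m′ 0 m′<p m′+[a+b]≡c+p*0 ⟨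
      GammaQuotient ∎
      where open SetoidReasoning ≈-setoid

    congruence : CongQ p 2 (F21-1 x₁ y₁ z c) GammaQuotient
    congruence = ≈⇒CongQ (subst (_≈ GammaQuotient) (sym (F21-1≡Σ≤ x₁ y₁ z c)) F21≈Γ)

  Factor : ℚ
  Factor = ((ℚℕ C + ℚℕ c) - (ℚℕ A + ℚℕ a)) - (ℚℕ B + ℚℕ b)

  module PartII (c<a+b : c < a ℕ.+ b) where
    m r₂ : ℕ
    m = (a ℕ.+ b) ∸ c
    r₂ = p ∸ m

    F N D ρ₂′ : ℚ
    F = z - x₁ - y₁ - ℚℕ m
    N = closedForm-num z c a b m x₁ y₁
    D = closedForm-den z c 0 x₁ y₁
    ρ₂′ = fromℤ (ρ₂ r₂)

    m+c≡a+b : m ℕ.+ c ≡ a ℕ.+ b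
    m+c≡a+b = ℕP.m∸n+n≡m (ℕP.<⇒≤ c<a+b)
    m<p : m < p
    m<p = ℕP.≤-<-trans (subst (m ≤_) (ℕP.m+n∸n≡m a b) (ℕP.∸-monoʳ-≤ (a ℕ.+ b) b≤c)) (ℕP.≤-<-trans a≤c c<p)
    r₂<p : r₂ < p
    r₂<p = ℕP.∸-monoʳ-< (ℕP.m<n⇒0<n∸m c<a+b) (ℕP.<⇒≤ m<p)
    m+r₂≡p : m ℕ.+ r₂ ≡ p
    m+r₂≡p = ℕP.m+[n∸m]≡n (ℕP.<⇒≤ m<p)
    r₂+[a+b]≡c+p*1 : r₂ ℕ.+ (a ℕ.+ b) ≡ c ℕ.+ p ℕ.* 1
    r₂+[a+b]≡c+p*1 = begin
      r₂ ℕ.+ (a ℕ.+ b)     ≡⟨ cong (r₂ ℕ.+_) (sym m+c≡a+b) ⟩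
      r₂ ℕ.+ (m ℕ.+ c)     ≡⟨ sym (ℕP.+-assoc r₂ m c) ⟩
      (r₂ ℕ.+ m) ℕ.+ c     ≡⟨ cong (ℕ._+ c) (trans (ℕP.+-comm r₂ m) m+r₂≡p) ⟩
      p ℕ.+ c              ≡⟨ ℕP.+-comm p c ⟩
      c ℕ.+ p              ≡⟨ cong (c ℕ.+_) (sym (ℕP.*-identityʳ p)) ⟩
      c ℕ.+ p ℕ.* 1        ∎
      where open ≡-Reasoning
    a+0≡[c-b]+m : a ℕ.+ 0 ≡ (c ∸ b) ℕ.+ m
    a+0≡[c-b]+m = trans (ℕP.+-identityʳ a) (sym ([c∸b]+[[a+b]∸c]≡a a b c b≤c (ℕP.<⇒≤ c<a+b)))
    b+0≡[c-a]+m : b ℕ.+ 0 ≡ (c ∸ a) ℕ.+ m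
    b+0≡[c-a]+m = trans (ℕP.+-identityʳ b) (sym (trans (cong (λ n → (c ∸ a) ℕ.+ (n ∸ c)) (ℕP.+-comm a b))
                                                       ([c∸b]+[[a+b]∸c]≡a b a c a≤c (subst (c ≤_) (ℕP.+-comm a b) (ℕP.<⇒≤ c<a+b)))))

    f : ℤ
    f = (+ (C ℕ.+ c) ℤ.- + (A ℕ.+ a)) ℤ.- + (B ℕ.+ b)
    p∣f : + p ∣ f
    p∣f = ℤD.∣m∣n⇒∣m-n (ℤD.∣m∣n⇒∣m-n (∣ᵤ⇒∣ {i = + (C ℕ.+ c)} p∣C+c) (∣ᵤ⇒∣ {i = + (A ℕ.+ a)} p∣A+a)) (∣ᵤ⇒∣ {i = + (B ℕ.+ b)} p∣B+b)
    fromℤf≡Factor : fromℤ f ≡ Factor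
    fromℤf≡Factor = trans (fromℤ-- (+ (C ℕ.+ c) ℤ.- + (A ℕ.+ a)) (+ (B ℕ.+ b)))
      (cong₂ _-_ (trans (fromℤ-- (+ (C ℕ.+ c)) (+ (A ℕ.+ a))) (cong₂ _-_ (ℚℕ-+ C c) (ℚℕ-+ A a))) (ℚℕ-+ B b))
    Factor≡F : Factor ≡ F
    Factor≡F = begin
      ((ℚℕ C + ℚℕ c) - (ℚℕ A + ℚℕ a)) - (ℚℕ B + ℚℕ b)
        ≡⟨ solve 6 (λ C c A a B b → ((C :+ c) :- (A :+ a)) :- (B :+ b) := C :- A :- B :- ((a :+ b) :- c)) refl (ℚℕ C) (ℚℕ c) (ℚℕ A) (ℚℕ a) (ℚℕ B) (ℚℕ b) ⟩
      z - x₁ - y₁ - ((ℚℕ a + ℚℕ b) - ℚℕ c)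
        ≡⟨ cong (λ t → z - x₁ - y₁ - (t - ℚℕ c)) (trans (sym (ℚℕ-+ a b)) (trans (cong ℚℕ (sym m+c≡a+b)) (ℚℕ-+ m c))) ⟩
      z - x₁ - y₁ - ((ℚℕ m + ℚℕ c) - ℚℕ c)
        ≡⟨ cong (λ t → z - x₁ - y₁ - t) (solve 2 (λ m c → (m :+ c) :- c := m) refl (ℚℕ m) (ℚℕ c)) ⟩
      F ∎
      where open ≡-Reasoning

    0≤ᵥF : 0 ≤ᵥ F
    0≤ᵥF = ≤ᵥ-- 0≤ᵥz-x₁-y₁ (0≤ᵥℚℕ m)
    ρ₂′-unit : IsUnitℚ ρ₂′
    ρ₂′-unit = ρ₂-unit r₂ 1 r₂<p r₂+[a+b]≡c+p*1
    ρ₁ρ₂-unit : IsUnitℚ (fromℤ (ρ₁ ℤ.* ρ₂ r₂))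
    ρ₁ρ₂-unit = subst IsUnitℚ (sym (fromℤ-* ρ₁ (ρ₂ r₂))) (IsUnitℚ-* ρ₁-unit ρ₂′-unit)

    -- (F)_m (F + m)_(p - m) = (F)_p ≡ F (p - 1)!, as F ≡ 0 (mod p).
    poch-F*ρ₂≈F*[p-1]! : poch F m * ρ₂′ ≈ F * fromℤ [p-1]!
    poch-F*ρ₂≈F*[p-1]! = begin
      poch F m * ρ₂′                 ≈⟨ ≈-* ≈-refl ρ₂≈poch (0≤ᵥ-poch m 0≤ᵥF) (0≤ᵥfromℤ (ρ₂ r₂)) ⟩
      poch F m * poch (F + ℚℕ m) r₂  ≡⟨ poch-+ F m r₂ ⟨
      poch F (m ℕ.+ r₂)              ≡⟨ cong₂ poch (trans (sym Factor≡F) (sym fromℤf≡Factor)) m+r₂≡p ⟩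
      poch (fromℤ f) p               ≈⟨ poch-multiple≈ f p∣f ⟩
      fromℤ f * fromℤ [p-1]!         ≡⟨ cong (_* fromℤ [p-1]!) (trans fromℤf≡Factor Factor≡F) ⟩
      F * fromℤ [p-1]!               ∎
      where
      open SetoidReasoning ≈-setoid
      ρ₂≈poch : ρ₂′ ≈ poch (F + ℚℕ m) r₂
      ρ₂≈poch = ≈-sym (poch≈rise g₂ r₂ (subst (ℚℕ g₂ ≈_) (solve 4 (λ z x y m → z :- x :- y := (z :- x :- y :- m) :+ m) refl z x₁ y₁ (ℚℕ m)) g₂≈z-x₁-y₁)
                                       (≤ᵥ-+ 0≤ᵥF (0≤ᵥℚℕ m)))

    N*ρ₂≈ : N * ρ₂′ ≈ (fromℤ ρ₃ * fromℤ ρ₄) * (F * fromℤ [p-1]!)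
    N*ρ₂≈ = ≈-trans (≈-reflexive (ℚP.*-assoc (poch (z - x₁) (c ∸ a) * poch (z - y₁) (c ∸ b)) (poch F m) ρ₂′))
                    (≈-* poch-z-x₁*poch-z-y₁≈ρ₃ρ₄ poch-F*ρ₂≈F*[p-1]! (≤ᵥ-* (0≤ᵥfromℤ ρ₃) (0≤ᵥfromℤ ρ₄)) (≤ᵥ-* (0≤ᵥ-poch m 0≤ᵥF) (0≤ᵥfromℤ (ρ₂ r₂))))

    D*ρ₂≡ρ₁ρ₂ : D * ρ₂′ ≡ fromℤ (ρ₁ ℤ.* ρ₂ r₂)
    D*ρ₂≡ρ₁ρ₂ = trans (cong (_* ρ₂′) (trans (ℚP.*-identityʳ (poch z c)) poch-z≡ρ₁)) (sym (fromℤ-* ρ₁ (ρ₂ r₂)))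

    pull-out-F : ((fromℤ ρ₃ * fromℤ ρ₄) * (F * fromℤ [p-1]!)) ÷' fromℤ (ρ₁ ℤ.* ρ₂ r₂)
                 ≡ F * (fromℤ ([p-1]! ℤ.^ 1 ℤ.* (ρ₃ ℤ.* ρ₄)) ÷' fromℤ (ρ₁ ℤ.* ρ₂ r₂))
    pull-out-F = begin
      ((r₃ * r₄) * (F * e)) ÷' d               ≡⟨ ÷'≡*1÷' ((r₃ * r₄) * (F * e)) d ⟩
      ((r₃ * r₄) * (F * e)) * (1ℚ ÷' d)        ≡⟨ solve 5 (λ a b F e w → ((a :* b) :* (F :* e)) :* w := F :* (((e :* con 1ℚ) :* (a :* b)) :* w)) refl r₃ r₄ F e (1ℚ ÷' d) ⟩
      F * (((e * 1ℚ) * (r₃ * r₄)) * (1ℚ ÷' d)) ≡⟨ cong (λ t → F * (t * (1ℚ ÷' d))) E^1ρ₃ρ₄ ⟨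
      F * (fromℤ ([p-1]! ℤ.^ 1 ℤ.* (ρ₃ ℤ.* ρ₄)) * (1ℚ ÷' d)) ≡⟨ cong (F *_) (÷'≡*1÷' _ d) ⟨
      F * (fromℤ ([p-1]! ℤ.^ 1 ℤ.* (ρ₃ ℤ.* ρ₄)) ÷' d) ∎
      where
      open ≡-Reasoning
      r₃ = fromℤ ρ₃
      r₄ = fromℤ ρ₄
      e = fromℤ [p-1]!
      d = fromℤ (ρ₁ ℤ.* ρ₂ r₂)
      E^1ρ₃ρ₄ : fromℤ ([p-1]! ℤ.^ 1 ℤ.* (ρ₃ ℤ.* ρ₄)) ≡ (e * 1ℚ) * (r₃ * r₄)
      E^1ρ₃ρ₄ = trans (fromℤ-* ([p-1]! ℤ.^ 1) (ρ₃ ℤ.* ρ₄)) (cong₂ _*_ (fromℤ-* [p-1]! (+ 1)) (fromℤ-* ρ₃ ρ₄))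

    F21≈Factor*Γ : Σ≤ (F21-term x₁ y₁ z) c ≈ Factor * GammaQuotient
    F21≈Factor*Γ = begin
      Σ≤ (F21-term x₁ y₁ z) c
        ≈⟨ F21≈closedForm m 0 a+0≡[c-b]+m b+0≡[c-a]+m (inj₂ refl) (IsUnitℚ-fromℤ p∤1) ⟩
      N ÷' D
        ≡⟨ ÷'-*-cancelʳ N D ρ₂′ (IsUnitℚ⇒≢0 ρ₂′-unit) ⟨
      (N * ρ₂′) ÷' (D * ρ₂′)
        ≈⟨ ≈-÷' N*ρ₂≈ (≈-reflexive D*ρ₂≡ρ₁ρ₂) (≤ᵥ-* (≤ᵥ-* (0≤ᵥfromℤ ρ₃) (0≤ᵥfromℤ ρ₄)) (≤ᵥ-* 0≤ᵥF (0≤ᵥfromℤ [p-1]!)))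
                (IsUnitℚ-* (IsUnitℚ-* (IsUnitℚ-poch-z c ℕP.≤-refl) (IsUnitℚ-fromℤ p∤1)) ρ₂′-unit) ρ₁ρ₂-unit ⟩
      ((fromℤ ρ₃ * fromℤ ρ₄) * (F * fromℤ [p-1]!)) ÷' fromℤ (ρ₁ ℤ.* ρ₂ r₂)
        ≡⟨ pull-out-F ⟩
      F * (fromℤ ([p-1]! ℤ.^ 1 ℤ.* (ρ₃ ℤ.* ρ₄)) ÷' fromℤ (ρ₁ ℤ.* ρ₂ r₂))
        ≈⟨ ≈-* ≈-refl (≈-sym (GammaQuotient≈ r₂ 1 r₂<p r₂+[a+b]≡c+p*1)) 0≤ᵥF (≤ᵥ-÷' (0≤ᵥfromℤ ([p-1]! ℤ.^ 1 ℤ.* (ρ₃ ℤ.* ρ₄))) ρ₁ρ₂-unit) ⟩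
      F * GammaQuotient
        ≡⟨ cong (_* GammaQuotient) Factor≡F ⟨
      Factor * GammaQuotient ∎
      where open SetoidReasoning ≈-setoid

    congruence : CongQ p 2 (F21-1 x₁ y₁ z c) (Factor * GammaQuotient)
    congruence = ≈⇒CongQ (subst (_≈ Factor * GammaQuotient) (sym (F21-1≡Σ≤ x₁ y₁ z c)) F21≈Factor*Γ)

open import Data.Nat using (_+_)
open import Data.Rational using (_*_)

theorem4p1 : (p : ℕ) → Prime p → p ≢ 2 →
    (α β γ : ℤₚ p) → IsUnit γ →
    negRes α ≤ negRes γ → negRes β ≤ negRes γ →
    (negRes α + negRes β ≤ negRes γ →
       Eventually (λ n → CongQ p 2 (F21Approx p α β γ n) (GammaQuot p α β γ n)))
    ×
    (negRes γ < negRes α + negRes β →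
       Eventually (λ n → CongQ p 2 (F21Approx p α β γ n)
                                   (FactorApprox p α β γ n * GammaQuot p α β γ n)))
theorem4p1 p p-prime p≢2 α β γ _ a≤c b≤c =
  (λ a+b≤c → 2 , λ { zero () ; (suc k) 2≤1+k → At.PartI.congruence k 2≤1+k a+b≤c }) ,
  (λ c<a+b → 2 , λ { zero () ; (suc k) 2≤1+k → At.PartII.congruence k 2≤1+k c<a+b })
  where
  module At (k : ℕ) (2≤1+k : 2 ≤ suc k) = AtRepresentatives p p-prime p≢2
    (trunc α (suc k)) (trunc β (suc k)) (trunc γ (suc k)) (negRes α) (negRes β) (negRes γ) (p ^ suc k)
    (^-monoʳ-∣ p 2≤1+k) (Digits.trunc<p^ α (suc k)) (Digits.trunc<p^ β (suc k))
    (Digits.p∣trunc+negRes α k) (Digits.p∣trunc+negRes β k) (Digits.p∣trunc+negRes γ k)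
    (Digits.negRes<p γ (ℕP.<-trans ℕP.0<1+n (PAdic.1<p p p-prime))) a≤c b≤c
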